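{- For every $h$ there are $\eta = \eta(h)>0$ and $\alpha = \alpha(h) > 0$ such that the following holds for every oriented graph $H$ on $h$ vertices. Let $H_1,\dots,H_{\ell}$ be a partition of $V(H)$ such that each $H_i$ induces an acyclic digraph, and for every $1 \leq i < j \leq \ell$, either $H_i \rightarrow H_j$ or $H_j \rightarrow H_i$. Let $W_1,\dots,W_{\ell}$ be pairwise-disjoint vertex sets in a tournament $T$ such that: (1) $|W_i| \geq 2^{h-1}$ for every $1 \leq i \leq \ell$; (2) for every $1 \leq i \neq j \leq \ell$, if $H_i \rightarrow H_j$ then $d(W_i,W_j) \geq 1 - \eta$. Then $T$ contains at least $\alpha \cdot \prod_{i=1}^{\ell}|W_i|^{h_i}$ copies of $H$, where $h_i = |H_i|$.
   Context: An oriented graph is a digraph without loops with at most one edge between any two distinct vertices; a tournament has exactly one. For disjoint vertex sets $X,Y$ of a digraph, $X\to Y$ means there is no pair $(x,y)\in X\times Y$ with an edge from $y$ to $x$. For disjoint $X,Y\subseteq V(T)$, $d(X,Y)$ is the fraction of pairs $(x,y)\in X\times Y$ with $(x,y)\in E(T)$. A copy of $H$ in $T$ is a (not necessarily induced) subgraph of $T$ isomorphic to $H$. -}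

module Defs where

open import Data.Nat as ℕ using (ℕ; zero; suc; _+_; _*_; _^_)
open import Data.Fin using (Fin; zero; suc; toℕ; fromℕ; inject₁)
open import Data.Fin.Subset using (Subset)
open import Data.Bool using (Bool; true; false; not; _∧_; if_then_else_)
open import Data.List using (List; map; foldr; allFin)
open import Data.Nat.ListAction using (sum)
open import Data.Vec using (lookup)
open import Data.Product using (Σ; _×_; ∃)
open import Data.Integer using (+_)
open import Data.Rational using (ℚ; _/_)
open import Relation.Binary.PropositionalEquality using (_≡_; _≢_)
open import Relation.Nullary using (¬_)
open import Function.Definitions using (Injective)

Digraph : ℕ → Set
Digraph k = Fin k → Fin k → Bool

IsOriented : {k : ℕ} → Digraph k → Set
IsOriented {k} A = ((x : Fin k) → A x x ≡ false)
                 × ((x y : Fin k) → A x y ≡ true → A y x ≡ false)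

IsTournament : {k : ℕ} → Digraph k → Set
IsTournament {k} T = ((x : Fin k) → T x x ≡ false)
                   × ((x y : Fin k) → x ≢ y → T x y ≡ not (T y x))

-- Cyclic successor on Fin (suc k):  j ↦ j+1, and the last element ↦ zero.
cyc : {k : ℕ} → Fin (suc k) → Fin (suc k)
cyc {zero} _ = zero
cyc {suc k} zero = suc zero
cyc {suc k} (suc j) with cyc {k} j
... | zero = zero
... | suc r = suc (suc r)

DirectedCycleIn : {h : ℕ} → Digraph h → (Fin h → Set) → Set
DirectedCycleIn {h} A P =
  Σ ℕ λ k → Σ (Fin (suc k) → Fin h) λ c →
    Injective _≡_ _≡_ c × ((j : Fin (suc k)) → P (c j)) ×
    ((j : Fin (suc k)) → A (c j) (c (cyc j)) ≡ true)

PartAcyclic : {h ℓ : ℕ} → Digraph h → (Fin h → Fin ℓ) → Fin ℓ → Set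
PartAcyclic A part i = ¬ DirectedCycleIn A (λ v → part v ≡ i)

-- H_i → H_j : no edge from a vertex of H_j to a vertex of H_i.
PartArrow : {h ℓ : ℕ} → Digraph h → (Fin h → Fin ℓ) → Fin ℓ → Fin ℓ → Set
PartArrow {h} A part i j =
  (x y : Fin h) → part x ≡ i → part y ≡ j → A y x ≡ false

partSize : {h ℓ : ℕ} → (Fin h → Fin ℓ) → Fin ℓ → ℕ
partSize {h} part i =
  sum (map (λ v → if toℕ (part v) ℕ.≡ᵇ toℕ i then 1 else 0) (allFin h))

edgeCount : {n : ℕ} → Digraph n → Subset n → Subset n → ℕ
edgeCount {n} T X Y =
  sum (map (λ x → sum (map (λ y →
         if lookup X x ∧ lookup Y y ∧ T x y then 1 else 0) (allFin n))) (allFin n))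

toℚ : ℕ → ℚ
toℚ m = + m / 1

prodFin : (ℓ : ℕ) → (Fin ℓ → ℕ) → ℕ
prodFin ℓ f = foldr (λ i acc → f i * acc) 1 (allFin ℓ)

-- An embedding of H into T: an injective map sending edges to edges;
-- its image (f(V(H)), f(E(H))) is a copy of H in T.
record Embedding {h n : ℕ} (H : Digraph h) (T : Digraph n) : Set where
  field
    emb   : Fin h → Fin n
    inj   : Injective _≡_ _≡_ emb
    edges : (a b : Fin h) → H a b ≡ true → T (emb a) (emb b) ≡ true
open Embedding public

SameCopy : {h n : ℕ} {H : Digraph h} {T : Digraph n} →
           Embedding H T → Embedding H T → Set
SameCopy {h} {n} {H} f g =
    ((a : Fin h) → ∃ λ b → emb f a ≡ emb g b)
  × ((b : Fin h) → ∃ λ a → emb f a ≡ emb g b)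
  × ((a b : Fin h) → H a b ≡ true → ∃ λ c → ∃ λ d →
        H c d ≡ true × emb f a ≡ emb g c × emb f b ≡ emb g d)
  × ((c d : Fin h) → H c d ≡ true → ∃ λ a → ∃ λ b →
        H a b ≡ true × emb f a ≡ emb g c × emb f b ≡ emb g d)

AtLeastCopies : {h n : ℕ} → Digraph h → Digraph n → ℕ → Set
AtLeastCopies H T m =
  Σ (Fin m → Embedding H T) λ cs →
    (i j : Fin m) → i ≢ j → ¬ SameCopy (cs i) (cs j)

module Submission where

-- Embed H greedily, one vertex at a time, in an order in which the edges inside every
-- part H_i go forward (it exists because each H_i is acyclic).  Every part keeps a set of
-- candidates inside its W_i.  The next vertex v of H_i is sent to a candidate x of large
-- out-degree among the candidates of H_i which has few "misfits" among the candidates of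
-- the other parts (vertices joined to x against the orientation between the parts); then
-- every candidate set shrinks to the vertices compatible with x.  As the density is close
-- to 1, averaging shows that a 1/C fraction of the candidates of H_i qualifies, while a
-- candidate set loses at most a factor 8 per step and keeps 2^(r-1) vertices while r of its
-- vertices remain.  Hence the tree of choices has at least ∏ |W_i|^(h_i) / C^h leaves.
-- Distinct leaves are distinct copies: where two branches first separate, at a vertex v,
-- the image of v dominates the images of all later vertices of its part, so equal vertex
-- sets would put both orientations of the edge between the two images of v into T.

open import Defs
open import Data.Nat as ℕ
  using (ℕ; zero; suc; _+_; _*_; _^_; _∸_; _≤_; _<_; z≤n; s≤s; _≤ᵇ_; _<ᵇ_; _≡ᵇ_; ⌊_/2⌋; ⌈_/2⌉; >-nonZero)
open import Data.Nat.Properties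
open import Data.Nat.Tactic.RingSolver using (solve-∀)
import Data.Nat.ListAction as List
open import Data.Nat.ListAction.Properties using (sum-↭)
open import Data.Nat.Coprimality using (1-coprimeTo) renaming (sym to coprime-sym)
import Data.Integer as ℤ
import Data.Integer.Properties as ℤ
open import Data.Rational using (ℚ; mkℚ; 0ℚ; 1ℚ; _-_; 1/_; *≤*; -_)
import Data.Rational as ℚ
import Data.Rational.Properties as ℚ
import Data.Rational.Unnormalised as ℚᵘ
import Data.Rational.Unnormalised.Properties as ℚᵘ
open import Data.Fin using (Fin; zero; suc; toℕ)
open import Data.Fin.Properties using (toℕ-injective; toℕ<n; pigeonhole; injective⇒≤)
  renaming (_≟_ to _≟ᶠ_; <-cmp to <-cmpᶠ; <-irrelevant to <-irrelevantᶠ; <-asym to <-asymᶠ)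
open import Data.Fin.Subset using (Subset; ∣_∣)
open import Data.Bool using (Bool; true; false; not; _∧_; if_then_else_)
open import Data.Bool.Properties using (T-≡; not-involutive; ∧-zeroʳ; ¬-not) renaming (_≟_ to _≟ᵇ_)
open import Data.Vec as Vec using ([]; _∷_)
open import Data.Vec.Properties using (lookup⇒[]=)
open import Data.Product using (Σ; _×_; ∃; _,_; proj₁; proj₂)
open import Data.Sum using (_⊎_; inj₁; inj₂; [_,_]′)
open import Data.Empty using (⊥; ⊥-elim)
open import Data.List using (List; []; _∷_; _++_; [_]; length; allFin; tabulate; foldr; map; lookup)
open import Data.List.Properties using (length-++; length-tabulate)
open import Data.List.Membership.Propositional.Properties
  using (∈-++⁻; ∈-++⁺ˡ; ∈-++⁺ʳ; ∈-∃++; ∈-allFin; ∈-lookup)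
open import Data.List.Relation.Unary.Any using (here; there; any?)
import Data.List.Relation.Unary.All as All
open import Data.List.Relation.Unary.All.Properties using (¬Any⇒All¬; ¬All⇒Any¬)
open import Data.List.Relation.Unary.AllPairs using (AllPairs; []; _∷_)
import Data.List.Relation.Unary.AllPairs as AllPairs
import Data.List.Relation.Unary.AllPairs.Properties as AllPairsₚ
open import Data.List.Relation.Unary.Unique.Propositional using (Unique)
open import Data.List.Relation.Unary.Unique.Propositional.Properties using (allFin⁺)
open import Data.List.Relation.Binary.Permutation.Propositional using (_↭_; prep; ↭-sym; ↭-trans; ↭-refl)
open import Data.List.Relation.Binary.Permutation.Propositional.Properties
  using (shift; ++-comm; ∈-resp-↭; ↭-length; map⁺)
open import Function using (_∘_; case_of_)
open import Function.Bundles using (Equivalence)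
open import Relation.Binary.PropositionalEquality hiding ([_])
open import Relation.Binary.Definitions using (tri<; tri≈; tri>)
open import Relation.Nullary using (¬_; yes; no)
open import Algebra.Properties.Semiring.Sum +-*-semiring
  using (sum; sum-syntax; sum-cong-≗; sum-replicate-zero; *-distribˡ-sum; *-distribʳ-sum)

𝟙 : Bool → ℕ
𝟙 b = if b then 1 else 0

𝟙≤1 : ∀ b → 𝟙 b ≤ 1
𝟙≤1 false = z≤n
𝟙≤1 true = s≤s z≤n

𝟙-split : ∀ a b → 𝟙 (a ∧ b) + 𝟙 (a ∧ not b) ≡ 𝟙 a
𝟙-split false b = refl
𝟙-split true false = refl
𝟙-split true true = refl

_==_ : ∀ {n} → Fin n → Fin n → Bool
a == b = toℕ a ≡ᵇ toℕ b

==-refl : ∀ {n} (a : Fin n) → (a == a) ≡ true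
==-refl zero = refl
==-refl (suc a) = ==-refl a

==⇒≡ : ∀ {n} (a b : Fin n) → (a == b) ≡ true → a ≡ b
==⇒≡ zero zero e = refl
==⇒≡ (suc a) (suc b) e = cong suc (==⇒≡ a b e)

sum-+ : ∀ n (f g : Fin n → ℕ) → ∑[ i < n ] (f i + g i) ≡ sum f + sum g
sum-+ zero f g = refl
sum-+ (suc n) f g rewrite sum-+ n (λ i → f (suc i)) (λ i → g (suc i)) = lem (f zero) (g zero) _ _
  where lem : ∀ a b c d → (a + b) + (c + d) ≡ (a + c) + (b + d)
        lem = solve-∀

sum-mono-≤ : ∀ n {f g : Fin n → ℕ} → (∀ i → f i ≤ g i) → sum f ≤ sum g
sum-mono-≤ zero _ = z≤n
sum-mono-≤ (suc n) f≤g = +-mono-≤ (f≤g zero) (sum-mono-≤ n (λ i → f≤g (suc i)))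

sum-swap : ∀ m n (f : Fin m → Fin n → ℕ) → ∑[ i < m ] ∑[ j < n ] f i j ≡ ∑[ j < n ] ∑[ i < m ] f i j
sum-swap zero n f = sym (sum-replicate-zero n)
sum-swap (suc m) n f rewrite sum-swap m n (λ i → f (suc i)) =
  sym (sum-+ n (f zero) (λ j → ∑[ i < m ] f (suc i) j))

sum-const : ∀ n c → ∑[ _ < n ] c ≡ n * c
sum-const zero c = refl
sum-const (suc n) c = cong (c +_) (sum-const n c)

sum-𝟙-== : ∀ n (x : Fin n) (f : Fin n → ℕ) → ∑[ i < n ] (𝟙 (i == x) * f i) ≡ f x
sum-𝟙-== (suc n) zero f = trans (cong (f zero + 0 +_) (sum-replicate-zero n)) (trans (+-identityʳ _) (+-identityʳ _))
sum-𝟙-== (suc n) (suc x) f = sum-𝟙-== n x (λ i → f (suc i))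

2*⌊n/2⌋≤n : ∀ n → 2 * ⌊ n /2⌋ ≤ n
2*⌊n/2⌋≤n n = begin
  2 * ⌊ n /2⌋        ≡⟨ cong (⌊ n /2⌋ +_) (+-identityʳ ⌊ n /2⌋) ⟩
  ⌊ n /2⌋ + ⌊ n /2⌋  ≤⟨ +-monoʳ-≤ ⌊ n /2⌋ (⌊n/2⌋≤⌈n/2⌉ n) ⟩
  ⌊ n /2⌋ + ⌈ n /2⌉  ≡⟨ ⌊n/2⌋+⌈n/2⌉≡n n ⟩
  n                  ∎
  where open ≤-Reasoning

n≤2*⌊n/2⌋+1 : ∀ n → n ≤ 2 * ⌊ n /2⌋ + 1
n≤2*⌊n/2⌋+1 zero = z≤n
n≤2*⌊n/2⌋+1 (suc zero) = s≤s z≤n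
n≤2*⌊n/2⌋+1 (suc (suc n)) = subst (suc (suc n) ≤_) (sym (lem ⌊ n /2⌋)) (s≤s (s≤s (n≤2*⌊n/2⌋+1 n)))
  where lem : ∀ a → 2 * suc a + 1 ≡ suc (suc (2 * a + 1))
        lem = solve-∀

≤ᵇ≡true⇒≤ : ∀ {m n} → (m ≤ᵇ n) ≡ true → m ≤ n
≤ᵇ≡true⇒≤ {m} {n} e = ≤ᵇ⇒≤ m n (Equivalence.from T-≡ e)

≤⇒≤ᵇ≡true : ∀ {m n} → m ≤ n → (m ≤ᵇ n) ≡ true
≤⇒≤ᵇ≡true m≤n = Equivalence.to T-≡ (≤⇒≤ᵇ m≤n)

≤ᵇ≡false⇒> : ∀ {m n} → (m ≤ᵇ n) ≡ false → n < m
≤ᵇ≡false⇒> e = ≰⇒> (λ m≤n → case trans (sym (≤⇒≤ᵇ≡true m≤n)) e of λ ())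

# : ∀ {n} → (Fin n → Bool) → ℕ
# {n} D = ∑[ x < n ] 𝟙 (D x)

#-split : ∀ {n} (D E : Fin n → Bool) → # (λ x → D x ∧ E x) + # (λ x → D x ∧ not (E x)) ≡ # D
#-split {n} D E = trans (sym (sum-+ n _ _)) (sum-cong-≗ (λ x → 𝟙-split (D x) (E x)))

-- Out-degrees in a tournament

module Tournament {n : ℕ} (T : Digraph n) (tour : IsTournament T) where

  private
    T-irrefl : ∀ x → T x x ≡ false
    T-irrefl = proj₁ tour
    T-flip : ∀ x y → x ≢ y → T x y ≡ not (T y x)
    T-flip = proj₂ tour

  outdeg : (Fin n → Bool) → Fin n → ℕ
  outdeg D x = # (λ y → D y ∧ T x y)

  highOut lowOut : (Fin n → Bool) → ℕ → ℕ
  highOut D g = # (λ x → D x ∧ (g ≤ᵇ outdeg D x))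
  lowOut D g = # (λ x → D x ∧ not (g ≤ᵇ outdeg D x))

  outdeg-sum : (Fin n → Bool) → ℕ
  outdeg-sum D = ∑[ x < n ] (𝟙 (D x) * outdeg D x)

  -- Each pair {x, y} of D contributes exactly one edge, and each x the diagonal term.
  handshake : ∀ D → outdeg-sum D + outdeg-sum D + # D ≡ # D * # D
  handshake D = begin
      outdeg-sum D + outdeg-sum D + # D
    ≡⟨ cong₂ (λ a b → a + b + # D) forward backward ⟩
      ∑[ x < n ] ∑[ y < n ] f₁ x y + ∑[ x < n ] ∑[ y < n ] f₂ x y + # D
    ≡⟨ cong (∑[ x < n ] ∑[ y < n ] f₁ x y + ∑[ x < n ] ∑[ y < n ] f₂ x y +_) (sym diagonal) ⟩
      ∑[ x < n ] ∑[ y < n ] f₁ x y + ∑[ x < n ] ∑[ y < n ] f₂ x y + ∑[ x < n ] ∑[ y < n ] f₃ x y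
    ≡⟨ sym (trans (sum-+ n (λ x → ∑[ y < n ] f₁ x y + ∑[ y < n ] f₂ x y) (λ x → ∑[ y < n ] f₃ x y))
                  (cong (_+ ∑[ x < n ] ∑[ y < n ] f₃ x y) (sum-+ n (λ x → ∑[ y < n ] f₁ x y) (λ x → ∑[ y < n ] f₂ x y)))) ⟩
      ∑[ x < n ] (∑[ y < n ] f₁ x y + ∑[ y < n ] f₂ x y + ∑[ y < n ] f₃ x y)
    ≡⟨ sum-cong-≗ (λ x → sym (trans (sum-+ n (λ y → f₁ x y + f₂ x y) (f₃ x)) (cong (_+ ∑[ y < n ] f₃ x y) (sum-+ n (f₁ x) (f₂ x))))) ⟩
      ∑[ x < n ] ∑[ y < n ] (f₁ x y + f₂ x y + f₃ x y)
    ≡⟨ sum-cong-≗ (λ x → sum-cong-≗ (pair x)) ⟩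
      ∑[ x < n ] ∑[ y < n ] (𝟙 (D x) * 𝟙 (D y))
    ≡⟨ sum-cong-≗ (λ x → sym (*-distribˡ-sum (𝟙 (D x)) (λ y → 𝟙 (D y)))) ⟩
      ∑[ x < n ] (𝟙 (D x) * # D)
    ≡⟨ sym (*-distribʳ-sum (# D) (λ x → 𝟙 (D x))) ⟩
      # D * # D
    ∎
    where
      open ≡-Reasoning
      f₁ f₂ f₃ : Fin n → Fin n → ℕ
      f₁ x y = 𝟙 (D x) * 𝟙 (D y ∧ T x y)
      f₂ x y = 𝟙 (D y) * 𝟙 (D x ∧ T y x)
      f₃ x y = 𝟙 (y == x) * (𝟙 (D x) * 𝟙 (D y))
      forward : outdeg-sum D ≡ ∑[ x < n ] ∑[ y < n ] f₁ x y
      forward = sum-cong-≗ (λ x → *-distribˡ-sum (𝟙 (D x)) (λ y → 𝟙 (D y ∧ T x y)))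
      backward : outdeg-sum D ≡ ∑[ x < n ] ∑[ y < n ] f₂ x y
      backward = trans forward (sum-swap n n f₁)
      diagonal : ∑[ x < n ] ∑[ y < n ] f₃ x y ≡ # D
      diagonal = sum-cong-≗ (λ x → trans (sum-𝟙-== n x (λ y → 𝟙 (D x) * 𝟙 (D y))) (idem (D x)))
        where idem : ∀ b → 𝟙 b * 𝟙 b ≡ 𝟙 b
              idem false = refl
              idem true = refl
      pair : ∀ x y → f₁ x y + f₂ x y + f₃ x y ≡ 𝟙 (D x) * 𝟙 (D y)
      pair x y with y == x in e
      ... | true with ==⇒≡ y x e
      ...   | refl rewrite T-irrefl x with D x
      ...     | true = refl
      ...     | false = refl
      pair x y | false rewrite T-flip x y (λ x≡y → case trans (sym (==-refl y)) (subst (λ z → (y == z) ≡ false) x≡y e) of λ ())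
                 with D x | D y | T y x
      ... | true | true | true = refl
      ... | true | true | false = refl
      ... | true | false | _ = refl
      ... | false | true | _ = refl
      ... | false | false | _ = refl

  outdeg<# : ∀ D x → D x ≡ true → outdeg D x + 1 ≤ # D
  outdeg<# D x Dx = begin
      outdeg D x + 1
    ≡⟨ cong (outdeg D x +_) (sym (trans (sum-𝟙-== n x (λ y → 𝟙 (D y))) (cong 𝟙 Dx))) ⟩
      outdeg D x + ∑[ y < n ] (𝟙 (y == x) * 𝟙 (D y))
    ≡⟨ sym (sum-+ n _ _) ⟩
      ∑[ y < n ] (𝟙 (D y ∧ T x y) + 𝟙 (y == x) * 𝟙 (D y))
    ≤⟨ sum-mono-≤ n pointwise ⟩
      # D
    ∎
    where
      open ≤-Reasoning
      pointwise : ∀ y → 𝟙 (D y ∧ T x y) + 𝟙 (y == x) * 𝟙 (D y) ≤ 𝟙 (D y)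
      pointwise y with y == x in e
      ... | true with ==⇒≡ y x e
      ...   | refl rewrite T-irrefl y with D y
      ...     | true = ≤-refl
      ...     | false = ≤-refl
      pointwise y | false rewrite +-identityʳ (𝟙 (D y ∧ T x y)) with D y
      ... | false = z≤n
      ... | true = 𝟙≤1 (T x y)

  highOut-ineq : ∀ D g → # D * # D + # D ≤ 2 * (highOut D g * # D + lowOut D g * g)
  highOut-ineq D g = begin
      # D * # D + # D
    ≡⟨ cong (_+ # D) (sym (handshake D)) ⟩
      outdeg-sum D + outdeg-sum D + # D + # D
    ≡⟨ lem (outdeg-sum D) (# D) ⟩
      2 * (outdeg-sum D + # D)
    ≤⟨ *-monoʳ-≤ 2 (begin
        outdeg-sum D + # D
      ≡⟨ sym (sum-+ n _ _) ⟩
        ∑[ x < n ] (𝟙 (D x) * outdeg D x + 𝟙 (D x))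
      ≤⟨ sum-mono-≤ n pointwise ⟩
        ∑[ x < n ] (𝟙 (D x ∧ (g ≤ᵇ outdeg D x)) * # D + 𝟙 (D x ∧ not (g ≤ᵇ outdeg D x)) * g)
      ≡⟨ sum-+ n _ _ ⟩
        ∑[ x < n ] (𝟙 (D x ∧ (g ≤ᵇ outdeg D x)) * # D) + ∑[ x < n ] (𝟙 (D x ∧ not (g ≤ᵇ outdeg D x)) * g)
      ≡⟨ sym (cong₂ _+_ (*-distribʳ-sum (# D) (λ x → 𝟙 (D x ∧ (g ≤ᵇ outdeg D x)))) (*-distribʳ-sum g (λ x → 𝟙 (D x ∧ not (g ≤ᵇ outdeg D x))))) ⟩
        highOut D g * # D + lowOut D g * g
      ∎) ⟩
      2 * (highOut D g * # D + lowOut D g * g)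
    ∎
    where
      open ≤-Reasoning
      lem : ∀ a b → a + a + b + b ≡ 2 * (a + b)
      lem = solve-∀
      pointwise : ∀ x → 𝟙 (D x) * outdeg D x + 𝟙 (D x) ≤
                  𝟙 (D x ∧ (g ≤ᵇ outdeg D x)) * # D + 𝟙 (D x ∧ not (g ≤ᵇ outdeg D x)) * g
      pointwise x with D x in eDx
      ... | false = z≤n
      ... | true with g ≤ᵇ outdeg D x in eg
      ...   | true = subst₂ _≤_ (sym (cong (_+ 1) (+-identityʳ _))) (sym (trans (+-identityʳ _) (+-identityʳ _)))
                             (outdeg<# D x eDx)
      ...   | false = subst₂ _≤_ (sym (trans (cong (_+ 1) (+-identityʳ _)) (+-comm _ 1))) (sym (+-identityʳ _))
                             (≤ᵇ≡false⇒> eg)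

  highOut+lowOut : ∀ D g → highOut D g + lowOut D g ≡ # D
  highOut+lowOut D g = #-split D (λ x → g ≤ᵇ outdeg D x)

  -- Averaging the handshake identity over D: few vertices can have small out-degree.
  highOut-large : ∀ D g → 1 ≤ # D → 4 * g ≤ # D → # D + 2 ≤ 4 * highOut D g
  highOut-large D g d≥1 4g≤d = arith (# D) (highOut D g) (lowOut D g) g d≥1 4g≤d (highOut+lowOut D g) (highOut-ineq D g)
    where
      arith : ∀ d s r g → 1 ≤ d → 4 * g ≤ d → s + r ≡ d → d * d + d ≤ 2 * (s * d + r * g) → d + 2 ≤ 4 * s
      arith d@(suc _) s r g _ 4g≤d s+r≡d ineq =
        *-cancelˡ-≤ d (subst (_≤ d * (4 * s)) (l4 d) (+-cancelˡ-≤ (d * d) _ _ step))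
        where
          open ≤-Reasoning
          rg : 4 * (r * g) ≤ d * d
          rg = begin
              4 * (r * g)  ≡⟨ l1 r g ⟩
              r * (4 * g)  ≤⟨ *-mono-≤ (subst (r ≤_) s+r≡d (m≤n+m r s)) 4g≤d ⟩
              d * d ∎
            where l1 : ∀ a b → 4 * (a * b) ≡ a * (4 * b)
                  l1 = solve-∀
          step : d * d + (d * d + 2 * d) ≤ d * d + d * (4 * s)
          step = begin
              d * d + (d * d + 2 * d)   ≡⟨ l2 d ⟩
              2 * (d * d + d)           ≤⟨ *-monoʳ-≤ 2 ineq ⟩
              2 * (2 * (s * d + r * g)) ≡⟨ l3 s d r g ⟩
              4 * (r * g) + d * (4 * s) ≤⟨ +-monoˡ-≤ (d * (4 * s)) rg ⟩
              d * d + d * (4 * s) ∎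
            where l2 : ∀ a → a * a + (a * a + 2 * a) ≡ 2 * (a * a + a)
                  l2 = solve-∀
                  l3 : ∀ s d r g → 2 * (2 * (s * d + r * g)) ≡ 4 * (r * g) + d * (4 * s)
                  l3 = solve-∀
          l4 : ∀ a → a * a + 2 * a ≡ a * (a + 2)
          l4 = solve-∀

  highOut-nonempty : ∀ D g → 1 ≤ # D → 2 * g ≤ # D → 1 ≤ highOut D g
  highOut-nonempty D g d≥1 2g≤d = arith (# D) (highOut D g) (lowOut D g) g d≥1 2g≤d (highOut+lowOut D g) (highOut-ineq D g)
    where
      arith : ∀ d s r g → 1 ≤ d → 2 * g ≤ d → s + r ≡ d → d * d + d ≤ 2 * (s * d + r * g) → 1 ≤ s
      arith d (suc s) r g _ _ _ _ = s≤s z≤n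
      arith d zero r g d≥1 2g≤d refl ineq = ⊥-elim (<⇒≱ lt (≤-trans ineq (≤-reflexive (l1 r g))))
        where
          open ≤-Reasoning
          l1 : ∀ r g → 2 * (0 * r + r * g) ≡ r * (2 * g)
          l1 = solve-∀
          lt : r * (2 * g) < r * r + r
          lt = begin-strict
            r * (2 * g) ≤⟨ *-monoʳ-≤ r 2g≤d ⟩
            r * r       <⟨ m<m+n (r * r) d≥1 ⟩
            r * r + r ∎

-- Ordering V(H) so that edges inside the parts go forward

cyc-toℕ : ∀ {k} (m : Fin (suc k)) → (toℕ (cyc m) ≡ suc (toℕ m)) ⊎ (toℕ m ≡ k × cyc m ≡ zero)
cyc-toℕ {zero} zero = inj₂ (refl , refl)
cyc-toℕ {suc k} zero = inj₁ refl
cyc-toℕ {suc k} (suc j) with cyc {k} j | cyc-toℕ {k} j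
... | zero | inj₁ ()
... | zero | inj₂ (p , _) = inj₂ (cong suc p , refl)
... | suc r | inj₁ q = inj₁ (cong suc q)
... | suc r | inj₂ (_ , ())

-- a may precede b in an order of V(H) whose edges inside a part all go forward
Precedes : ∀ {h ℓ} → Digraph h → (Fin h → Fin ℓ) → Fin h → Fin h → Set
Precedes H part a b = a ≢ b × (part a ≡ part b → H b a ≡ false)

module TopologicalOrder {h ℓ : ℕ} (H : Digraph h) (part : Fin h → Fin ℓ)
                        (acyclic : ∀ i → PartAcyclic H part i) where

  open import Data.List.Membership.Propositional using (_∈_; find)

  innerEdge : Fin h → Fin h → Bool
  innerEdge a b = H a b ∧ (part a == part b)

  innerEdge⇒edge : ∀ a b → innerEdge a b ≡ true → H a b ≡ true
  innerEdge⇒edge a b e with H a b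
  ... | true = refl

  innerEdge⇒samePart : ∀ a b → innerEdge a b ≡ true → part a ≡ part b
  innerEdge⇒samePart a b e with H a b
  ... | true = ==⇒≡ (part a) (part b) e

  samePart⇒innerEdge : ∀ a b → part a ≡ part b → innerEdge a b ≡ H a b
  samePart⇒innerEdge a b p rewrite p | ==-refl (part b) with H a b
  ... | true = refl
  ... | false = refl

  -- Walks of length h + 1 repeat a vertex; the first repetition closes a cycle inside one part.
  module _ (w : ℕ → Fin h) (step : ∀ k → innerEdge (w k) (w (suc k)) ≡ true) where

    private
      samePart : ∀ k → part (w k) ≡ part (w 0)
      samePart zero = refl
      samePart (suc k) = trans (sym (innerEdge⇒samePart _ _ (step k))) (samePart k)

      InjectiveBelow : ℕ → Set
      InjectiveBelow k = ∀ a b → a < k → b < k → w a ≡ w b → a ≡ b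

      seenBefore : ∀ k m → (Σ ℕ λ i → i < m × w i ≡ w k) ⊎ (∀ i → i < m → w i ≢ w k)
      seenBefore k zero = inj₂ (λ i ())
      seenBefore k (suc m) with seenBefore k m
      ... | inj₁ (i , i<m , e) = inj₁ (i , m<n⇒m<1+n i<m , e)
      ... | inj₂ unseen with w m ≟ᶠ w k
      ...   | yes e = inj₁ (m , ≤-refl , e)
      ...   | no ne = inj₂ unseen′
        where unseen′ : ∀ i → i < suc m → w i ≢ w k
              unseen′ i (s≤s i≤m) with m≤n⇒m<n∨m≡n i≤m
              ... | inj₁ i<m = unseen i i<m
              ... | inj₂ refl = ne

      firstRepeat : ∀ k → InjectiveBelow k ⊎ (Σ ℕ λ j → Σ ℕ λ i → i < j × w i ≡ w j × InjectiveBelow j)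
      firstRepeat zero = inj₁ (λ a b ())
      firstRepeat (suc k) with firstRepeat k
      ... | inj₂ r = inj₂ r
      ... | inj₁ inj with seenBefore k k
      ...   | inj₁ (i , i<k , e) = inj₂ (k , i , i<k , e , inj)
      ...   | inj₂ unseen = inj₁ inj′
        where inj′ : InjectiveBelow (suc k)
              inj′ a b (s≤s a≤k) (s≤s b≤k) e with m≤n⇒m<n∨m≡n a≤k | m≤n⇒m<n∨m≡n b≤k
              ... | inj₁ a<k | inj₁ b<k = inj a b a<k b<k e
              ... | inj₁ a<k | inj₂ refl = ⊥-elim (unseen a a<k e)
              ... | inj₂ refl | inj₁ b<k = ⊥-elim (unseen b b<k (sym e))
              ... | inj₂ refl | inj₂ refl = refl

      ¬InjectiveBelow : ¬ InjectiveBelow (suc h)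
      ¬InjectiveBelow inj with pigeonhole (n<1+n h) (λ a → w (toℕ a))
      ... | a , b , a<b , e = <-irrefl (inj (toℕ a) (toℕ b) (toℕ<n a) (toℕ<n b) e) a<b

      cycle : ∀ i j → i < j → w i ≡ w j → InjectiveBelow j → DirectedCycleIn H (λ v → part v ≡ part (w 0))
      cycle i j i<j wi≡wj inj = k , c , c-injective , (λ m → samePart (i + toℕ m)) , c-edge
        where
          k : ℕ
          k = j ∸ suc i
          j≡ : j ≡ suc (i + k)
          j≡ = sym (m+[n∸m]≡n i<j)
          c : Fin (suc k) → Fin h
          c m = w (i + toℕ m)
          below : ∀ m → i + toℕ m < j
          below m = subst (i + toℕ m <_) (sym j≡) (s≤s (+-monoʳ-≤ i (ℕ.s≤s⁻¹ (toℕ<n m))))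
          c-injective : ∀ {m m′} → c m ≡ c m′ → m ≡ m′
          c-injective {m} {m′} e = toℕ-injective (+-cancelˡ-≡ i _ _ (inj _ _ (below m) (below m′) e))
          c-edge : ∀ m → H (c m) (c (cyc m)) ≡ true
          c-edge m with cyc-toℕ m
          ... | inj₁ next = innerEdge⇒edge _ _ (subst (λ z → innerEdge (c m) (w z) ≡ true)
                                (sym (trans (cong (i +_) next) (+-suc i (toℕ m)))) (step (i + toℕ m)))
          ... | inj₂ (last , wrap) = innerEdge⇒edge _ _ (subst (λ z → innerEdge (c m) z ≡ true) (sym closes) (step (i + toℕ m)))
            where closes : c (cyc m) ≡ w (suc (i + toℕ m))
                  closes = trans (cong (λ z → w (i + toℕ z)) wrap)
                           (trans (cong w (+-identityʳ i))
                           (trans wi≡wj (cong w (trans j≡ (cong (λ z → suc (i + z)) (sym last))))))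

    innerWalk-impossible : ⊥
    innerWalk-impossible with firstRepeat (suc h)
    ... | inj₁ inj = ¬InjectiveBelow inj
    ... | inj₂ (j , i , i<j , e , inj) = acyclic (part (w 0)) (cycle i j i<j e inj)

  IsSink : List (Fin h) → Fin h → Set
  IsSink L x = All.All (λ y → innerEdge x y ≡ false) L

  findSink : ∀ L {x₀} → x₀ ∈ L → ∃ λ x → x ∈ L × IsSink L x
  findSink L x₀∈L with any? (λ x → All.all? (λ y → innerEdge x y ≟ᵇ false) L) L
  ... | yes sink = find sink
  ... | no noSink = ⊥-elim (innerWalk-impossible (λ k → proj₁ (path k)) (λ k → proj₂ (proj₂ (successor (proj₂ (path k))))))
    where
      successor : ∀ {x} → x ∈ L → ∃ λ y → y ∈ L × innerEdge x y ≡ true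
      successor x∈L with find (¬All⇒Any¬ (λ y → innerEdge _ y ≟ᵇ false) L (All.lookup (¬Any⇒All¬ L noSink) x∈L))
      ... | y , y∈L , ¬false = y , y∈L , ¬-not ¬false
      path : ℕ → ∃ λ x → x ∈ L
      path zero = _ , x₀∈L
      path (suc k) = let y , y∈L , _ = successor (proj₂ (path k)) in y , y∈L

  private
    ∈-insert : ∀ (ys : List (Fin h)) {x zs u} → u ∈ ys ++ zs → u ∈ ys ++ x ∷ zs
    ∈-insert ys u∈ with ∈-++⁻ ys u∈
    ... | inj₁ u∈ys = ∈-++⁺ˡ u∈ys
    ... | inj₂ u∈zs = ∈-++⁺ʳ ys (there u∈zs)

    unique-delete : ∀ (ys : List (Fin h)) {x zs} → Unique (ys ++ x ∷ zs) → Unique (ys ++ zs) × (∀ u → u ∈ ys ++ zs → u ≢ x)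
    unique-delete [] (x∉ ∷ uniq) = uniq , (λ u u∈ u≡x → All.lookup x∉ u∈ (sym u≡x))
    unique-delete (y ∷ ys) {x} {zs} (y∉ ∷ uniq) with unique-delete ys uniq
    ... | uniq′ , ≢x = All.tabulate (λ u∈ → All.lookup y∉ (∈-insert ys u∈)) ∷ uniq′ , ≢x′
      where ≢x′ : ∀ u → u ∈ y ∷ ys ++ zs → u ≢ x
            ≢x′ u (here refl) = All.lookup y∉ (∈-++⁺ʳ ys (here refl))
            ≢x′ u (there u∈) = ≢x u u∈

  -- The order is built from the back, by repeatedly removing a sink of the remaining vertices.
  topologicalSort : ∀ k (L : List (Fin h)) → length L ≡ k → Unique L →
                    Σ (List (Fin h)) λ S → S ↭ L × AllPairs (Precedes H part) S
  topologicalSort zero [] _ _ = [] , ↭-refl , []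
  topologicalSort (suc k) (l ∷ L) len uniq with findSink (l ∷ L) (here refl)
  ... | x , x∈ , sink with ∈-∃++ x∈
  ...   | ys , zs , L≡ = S ++ [ x ] , S++x↭L , AllPairsₚ.++⁺ ordered (All.[] ∷ []) (All.tabulate (λ u∈S → before u∈S All.∷ All.[]))
    where
      uniq′ : Unique (ys ++ zs) × (∀ u → u ∈ ys ++ zs → u ≢ x)
      uniq′ = unique-delete ys {x} {zs} (subst Unique L≡ uniq)
      len′ : length (ys ++ zs) ≡ k
      len′ = suc-injective (begin
        suc (length (ys ++ zs))  ≡⟨ cong suc (length-++ ys) ⟩
        suc (length ys + length zs) ≡⟨ sym (+-suc (length ys) (length zs)) ⟩
        length ys + length (x ∷ zs) ≡⟨ sym (length-++ ys) ⟩
        length (ys ++ x ∷ zs) ≡⟨ cong length (sym L≡) ⟩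
        length (l ∷ L) ≡⟨ len ⟩
        suc k ∎)
        where open ≡-Reasoning
      rest : Σ (List (Fin h)) λ S → S ↭ ys ++ zs × AllPairs (Precedes H part) S
      rest = topologicalSort k (ys ++ zs) len′ (proj₁ uniq′)
      S : List (Fin h)
      S = proj₁ rest
      S↭ : S ↭ ys ++ zs
      S↭ = proj₁ (proj₂ rest)
      ordered : AllPairs (Precedes H part) S
      ordered = proj₂ (proj₂ rest)
      S++x↭L : S ++ [ x ] ↭ l ∷ L
      S++x↭L = ↭-trans (++-comm S [ x ]) (↭-trans (prep x S↭) (subst (x ∷ ys ++ zs ↭_) (sym L≡) (↭-sym (shift x ys zs))))
      before : ∀ {u} → u ∈ S → Precedes H part u x
      before u∈S = proj₂ uniq′ _ u∈ , λ pu≡px →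
          trans (sym (samePart⇒innerEdge x _ (sym pu≡px))) (All.lookup sink (subst (_ ∈_) (sym L≡) (∈-insert ys {x} {zs} u∈)))
        where u∈ : _ ∈ ys ++ zs
              u∈ = ∈-resp-↭ S↭ u∈S

-- Candidate sets and the greedy step

reserve : ℕ → ℕ
reserve zero = 0
reserve (suc r) = 2 ^ r

reserve-pos : ∀ r → 1 ≤ r → 1 ≤ reserve r
reserve-pos (suc r) _ = m^n>0 2 r

reserve-suc : ∀ r → 1 ≤ r → reserve (suc r) ≡ 2 * reserve r
reserve-suc (suc r) _ = refl

2*reserve≤2^ : ∀ {r h} → r ≤ h → 2 * reserve r ≤ 2 ^ h
2*reserve≤2^ {zero} _ = z≤n
2*reserve≤2^ {suc r} r<h = ^-monoʳ-≤ 2 r<h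

4*⌊⌊n/2⌋/2⌋≤n : ∀ n → 4 * ⌊ ⌊ n /2⌋ /2⌋ ≤ n
4*⌊⌊n/2⌋/2⌋≤n n = begin
  4 * ⌊ ⌊ n /2⌋ /2⌋        ≡⟨ *-assoc 2 2 ⌊ ⌊ n /2⌋ /2⌋ ⟩
  2 * (2 * ⌊ ⌊ n /2⌋ /2⌋)  ≤⟨ *-monoʳ-≤ 2 (2*⌊n/2⌋≤n ⌊ n /2⌋) ⟩
  2 * ⌊ n /2⌋              ≤⟨ 2*⌊n/2⌋≤n n ⟩
  n                        ∎
  where open ≤-Reasoning

-- a ≤ ⌊ d /2⌋ because 2 a ≤ d ≤ 2 ⌊ d /2⌋ + 1 < 2 (⌊ d /2⌋ + 1).
≤⌊/2⌋ : ∀ a d → 2 * a ≤ d → a ≤ ⌊ d /2⌋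
≤⌊/2⌋ a d 2a≤d = m<1+n⇒m≤n (*-cancelˡ-< 2 a (suc ⌊ d /2⌋) (begin-strict
  2 * a               ≤⟨ 2a≤d ⟩
  d                   ≤⟨ n≤2*⌊n/2⌋+1 d ⟩
  2 * ⌊ d /2⌋ + 1     <⟨ lem ⌊ d /2⌋ ⟩
  2 * suc ⌊ d /2⌋     ∎))
  where
    open ≤-Reasoning
    lem : ∀ q → 2 * q + 1 < 2 * suc q
    lem q = ≤-reflexive (lem′ q)
      where lem′ : ∀ q → suc (2 * q + 1) ≡ 2 * suc q
            lem′ = solve-∀

half-bounds : ∀ a d → 1 ≤ a → 2 * a ≤ d → a ≤ ⌊ d /2⌋ × d ≤ 8 * ⌊ d /2⌋
half-bounds a d a≥1 2a≤d = a≤q , (begin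
    d          ≤⟨ n≤2*⌊n/2⌋+1 d ⟩
    2 * q + 1  ≤⟨ +-monoʳ-≤ (2 * q) (≤-trans a≥1 a≤q) ⟩
    2 * q + q  ≡⟨ lem q ⟩
    3 * q      ≤⟨ *-monoˡ-≤ q (s≤s (s≤s (s≤s (z≤n {5})))) ⟩
    8 * q      ∎)
  where
    open ≤-Reasoning
    q : ℕ
    q = ⌊ d /2⌋
    a≤q : a ≤ q
    a≤q = ≤⌊/2⌋ a d 2a≤d
    lem : ∀ q → 2 * q + q ≡ 3 * q
    lem = solve-∀

quarter-bounds : ∀ a d → 1 ≤ a → 4 * a ≤ d → a ≤ ⌊ ⌊ d /2⌋ /2⌋ × d ≤ 8 * ⌊ ⌊ d /2⌋ /2⌋
quarter-bounds a d a≥1 4a≤d = a≤q , (begin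
    d                  ≤⟨ n≤2*⌊n/2⌋+1 d ⟩
    2 * ⌊ d /2⌋ + 1    ≤⟨ +-monoˡ-≤ 1 (*-monoʳ-≤ 2 (n≤2*⌊n/2⌋+1 ⌊ d /2⌋)) ⟩
    2 * (2 * q + 1) + 1 ≡⟨ lem q ⟩
    4 * q + 3          ≤⟨ +-monoʳ-≤ (4 * q) (≤-trans (s≤s (s≤s (s≤s (z≤n {1})))) (*-monoʳ-≤ 4 (≤-trans a≥1 a≤q))) ⟩
    4 * q + 4 * q      ≡⟨ lem′ q ⟩
    8 * q              ∎)
  where
    open ≤-Reasoning
    q : ℕ
    q = ⌊ ⌊ d /2⌋ /2⌋
    a≤q : a ≤ q
    a≤q = ≤⌊/2⌋ a ⌊ d /2⌋ (≤⌊/2⌋ (2 * a) d (≤-trans (≤-reflexive (sym (*-assoc 2 2 a))) 4a≤d))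
    lem : ∀ q → 2 * (2 * q + 1) + 1 ≡ 4 * q + 3
    lem = solve-∀
    lem′ : ∀ q → 4 * q + 4 * q ≡ 8 * q
    lem′ = solve-∀

∧≡true : ∀ {a b} → (a ∧ b) ≡ true → a ≡ true × b ≡ true
∧≡true {true} e = refl , e

-- With η = 1/sparsity h, the spoiled candidates number at most badFactor h · |D_i| / sparsity h,
-- under an eighth of D_i, and none at all when D_i is small; branchLoss h = C is the loss per step.
markovFactor badFactor sparsity branchLoss : ℕ → ℕ
markovFactor h = 2 * 8 ^ h * 2 ^ h
badFactor h = h * markovFactor h * 8 ^ h
sparsity h = suc (8 * badFactor h * 2 ^ h)
branchLoss h = 8 * 8 ^ h * 2 ^ h

backPairs : ∀ {n} → Digraph n → (Fin n → Bool) → (Fin n → Bool) → ℕ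
backPairs {n} T X Y = ∑[ x < n ] ∑[ y < n ] 𝟙 (X x ∧ (Y y ∧ not (T x y)))

allᶠ : (m : ℕ) → (Fin m → Bool) → Bool
allᶠ zero p = true
allᶠ (suc m) p = p zero ∧ allᶠ m (λ j → p (suc j))

allᶠ-true : ∀ m p → allᶠ m p ≡ true → ∀ j → p j ≡ true
allᶠ-true (suc m) p e j with p zero in p₀ | j
... | true | zero = p₀
... | true | suc j′ = allᶠ-true m (λ j → p (suc j)) e j′

allᶠ-false : ∀ m p → allᶠ m p ≡ false → 1 ≤ ∑[ j < m ] 𝟙 (not (p j))
allᶠ-false (suc m) p e with p zero
... | false = s≤s z≤n
... | true = ≤-trans (allᶠ-false m (λ j → p (suc j)) e) (m≤n+m _ 0)

-- The Markov-type estimate: few x have τ-many misfits when misfits are sparse overall.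
markov : ∀ Q count τ c e B Ni Nj → τ * count ≤ c * B → Nj ≤ e * τ → Q * B ≤ Ni * Nj → 1 ≤ Nj →
         Q * count ≤ e * c * Ni
markov Q count τ c e B Ni Nj@(suc _) τcount≤cB Nj≤eτ QB≤NiNj _ = *-cancelʳ-≤ (Q * count) (e * c * Ni) Nj (begin
    Q * count * Nj        ≤⟨ *-monoʳ-≤ (Q * count) Nj≤eτ ⟩
    Q * count * (e * τ)   ≡⟨ l₁ Q count e τ ⟩
    e * Q * (τ * count)   ≤⟨ *-monoʳ-≤ (e * Q) τcount≤cB ⟩
    e * Q * (c * B)       ≡⟨ l₂ e Q c B ⟩
    e * c * (Q * B)       ≤⟨ *-monoʳ-≤ (e * c) QB≤NiNj ⟩
    e * c * (Ni * Nj)     ≡⟨ sym (*-assoc (e * c) Ni Nj) ⟩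
    e * c * Ni * Nj       ∎)
  where
    open ≤-Reasoning
    l₁ : ∀ a b c d → a * b * (c * d) ≡ c * a * (d * b)
    l₁ = solve-∀
    l₂ : ∀ a b c d → a * b * (c * d) ≡ a * c * (b * d)
    l₂ = solve-∀

module Candidates {n : ℕ} (T : Digraph n) (tour : IsTournament T)
                  {h ℓ : ℕ} (ℓ≤h : ℓ ≤ h) (W : Fin ℓ → Fin n → Bool)
                  (dir : Fin ℓ → Fin ℓ → Bool)
                  (dir-refl : ∀ i → dir i i ≡ true)
                  (dir-flip : ∀ i j → i ≢ j → dir i j ≡ not (dir j i))
                  (back-sparse : ∀ i j → i ≢ j → dir i j ≡ true →
                                 sparsity h * backPairs T (W i) (W j) ≤ # (W i) * # (W j))
                  (W-nonempty : ∀ i → 1 ≤ # (W i)) where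

  open Tournament T tour public

  N : Fin ℓ → ℕ
  N i = # (W i)

  -- x ∈ part i and y ∈ part j are placed consistently with the orientation dir of the parts.
  fits : Fin ℓ → Fin n → Fin ℓ → Fin n → Bool
  fits i x j y = if dir i j then T x y else T y x

  fits-irrefl : ∀ i x j → fits i x j x ≡ false
  fits-irrefl i x j with dir i j
  ... | true = proj₁ tour x
  ... | false = proj₁ tour x

  fits-inside : ∀ i x y → fits i x i y ≡ T x y
  fits-inside i x y rewrite dir-refl i = refl

  misfits : Fin ℓ → Fin ℓ → ℕ
  misfits i j = ∑[ x < n ] ∑[ y < n ] 𝟙 (W i x ∧ (W j y ∧ not (fits i x j y)))

  misfits-sparse : ∀ i j → i ≢ j → sparsity h * misfits i j ≤ N i * N j
  misfits-sparse i j i≢j with dir i j in e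
  ... | true = back-sparse i j i≢j e
  ... | false = subst₂ _≤_ (cong (sparsity h *_) swapped) (*-comm (N j) (N i)) (back-sparse j i (i≢j ∘ sym) dir-ji)
    where
      dir-ji : dir j i ≡ true
      dir-ji = trans (sym (not-involutive (dir j i))) (cong not (trans (sym (dir-flip i j i≢j)) e))
      ∧-swap : ∀ a b c → (a ∧ (b ∧ c)) ≡ (b ∧ (a ∧ c))
      ∧-swap false false c = refl
      ∧-swap false true c = refl
      ∧-swap true b c = refl
      swapped : backPairs T (W j) (W i) ≡ ∑[ x < n ] ∑[ y < n ] 𝟙 (W i x ∧ (W j y ∧ not (T y x)))
      swapped = trans (sum-swap n n _) (sum-cong-≗ (λ x → sum-cong-≗ (λ y → cong 𝟙 (∧-swap (W j y) (W i x) _))))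

  -- r vertices of part j remain to be embedded, and t steps have shrunk D_j by at most 8^t.
  WellSized : ℕ → (Fin n → Bool) → ℕ → Fin ℓ → Set
  WellSized t E r j = reserve r ≤ # E × N j ≤ 8 ^ t * # E

  -- The next vertex goes to part i; its image x is chosen among the candidates D i,
  -- and then the candidates of every part j shrink to restrict x j.
  module Step (D : Fin ℓ → Fin n → Bool) (D⊆W : ∀ j y → D j y ≡ true → W j y ≡ true)
              (r : Fin ℓ → ℕ) (r≤h : ∀ j → r j ≤ h) (t : ℕ) (t≤h : t ≤ h)
              (sized : ∀ j → 1 ≤ r j → WellSized t (D j) (r j) j)
              (i : Fin ℓ) (r-i≥1 : 1 ≤ r i) where

    misfitsAt : Fin ℓ → Fin n → ℕ
    misfitsAt j x = # (λ y → D j y ∧ not (fits i x j y))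

    keeps : Fin ℓ → Fin n → Bool
    keeps j x = (2 * misfitsAt j x ≤ᵇ # (D j)) ∧ (misfitsAt j x + reserve (r j) ≤ᵇ # (D j))

    spoils : Fin ℓ → Fin n → Bool
    spoils j x = not (j == i) ∧ ((0 <ᵇ r j) ∧ not (keeps j x))

    d : ℕ
    d = # (D i)

    roomy : Bool
    roomy = 2 * reserve (r i) ≤ᵇ d

    -- the out-degree threshold for the image of the new vertex
    g : ℕ
    g = if roomy then ⌊ ⌊ d /2⌋ /2⌋ else ⌊ d /2⌋

    high good : Fin n → Bool
    high x = D i x ∧ (g ≤ᵇ outdeg (D i) x)
    good x = high x ∧ allᶠ ℓ (λ j → not (spoils j x))

    spoiled : Fin ℓ → ℕ
    spoiled j = # (λ x → D i x ∧ spoils j x)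

    restrict : Fin n → Fin ℓ → Fin n → Bool
    restrict x j y = D j y ∧ fits i x j y

    private
      Q C F P : ℕ
      Q = sparsity h
      C = branchLoss h
      F = markovFactor h
      P = badFactor h

    misfitsAt-total : ∀ j → ∑[ x < n ] (𝟙 (D i x) * misfitsAt j x) ≤ misfits i j
    misfitsAt-total j = sum-mono-≤ n (λ x → ≤-trans (≤-reflexive (*-distribˡ-sum (𝟙 (D i x)) (λ y → 𝟙 (D j y ∧ not (fits i x j y)))))
                          (sum-mono-≤ n (λ y → shrink (D i x) (D j y) (not (fits i x j y)) (D⊆W i x) (D⊆W j y))))
      where
        shrink : ∀ a b c {a′ b′} → (a ≡ true → a′ ≡ true) → (b ≡ true → b′ ≡ true) →
                 𝟙 a * 𝟙 (b ∧ c) ≤ 𝟙 (a′ ∧ (b′ ∧ c))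
        shrink false b c _ _ = z≤n
        shrink true false c _ _ = z≤n
        shrink true true false _ _ = z≤n
        shrink true true true p q rewrite p refl | q refl = ≤-refl

    spoils⇒unkept : ∀ j x → spoils j x ≡ true → 1 ≤ r j × keeps j x ≡ false
    spoils⇒unkept j x e with j == i | r j | keeps j x
    ... | false | suc _ | false = s≤s z≤n , refl

    unkept-misfits : ∀ m R c → R ≤ c → ((2 * m ≤ᵇ c) ∧ (m + R ≤ᵇ c)) ≡ false →
                     1 ≤ m × (2 * R ≤ c → c + 1 ≤ 2 * m)
    unkept-misfits m R c R≤c e with 2 * m ≤ᵇ c in e₁ | m + R ≤ᵇ c in e₂
    ... | false | _ = n≢0⇒n>0 (λ m≡0 → case trans (sym (≤⇒≤ᵇ≡true (z≤n {c}))) (subst (λ k → (2 * k ≤ᵇ c) ≡ false) m≡0 e₁) of λ ()) ,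
                      λ _ → subst (_≤ 2 * m) (+-comm 1 c) (≤ᵇ≡false⇒> e₁)
    ... | true | false = n≢0⇒n>0 (λ m≡0 → <⇒≱ (subst (λ k → c < k + R) m≡0 c<m+R) R≤c) , many
      where
        open ≤-Reasoning
        c<m+R : c < m + R
        c<m+R = ≤ᵇ≡false⇒> e₂
        many : 2 * R ≤ c → c + 1 ≤ 2 * m
        many 2R≤c = +-cancelʳ-≤ (2 * R) _ _ (begin
          c + 1 + 2 * R       ≤⟨ +-monoʳ-≤ (c + 1) 2R≤c ⟩
          c + 1 + c           ≤⟨ ≤-trans (≤-reflexive (l₁ c)) (m≤n+m _ 1) ⟩
          1 + (2 * c + 1)     ≡⟨ l₂ c ⟩
          2 * suc c           ≤⟨ *-monoʳ-≤ 2 c<m+R ⟩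
          2 * (m + R)         ≡⟨ *-distribˡ-+ 2 m R ⟩
          2 * m + 2 * R       ∎)
          where l₁ : ∀ a → a + 1 + a ≡ 2 * a + 1
                l₁ = solve-∀
                l₂ : ∀ a → 1 + (2 * a + 1) ≡ 2 * suc a
                l₂ = solve-∀

    spoiled≤misfits : ∀ j → spoiled j ≤ misfits i j
    spoiled≤misfits j = ≤-trans (sum-mono-≤ n pointwise) (misfitsAt-total j)
      where
        pointwise : ∀ x → 𝟙 (D i x ∧ spoils j x) ≤ 𝟙 (D i x) * misfitsAt j x
        pointwise x with D i x | spoils j x in s
        ... | false | _ = z≤n
        ... | true | false = z≤n
        ... | true | true with spoils⇒unkept j x s
        ...   | r≥1 , unkept = ≤-trans (proj₁ (unkept-misfits (misfitsAt j x) (reserve (r j)) (# (D j)) (proj₁ (sized j r≥1)) unkept))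
                                       (≤-reflexive (sym (+-identityʳ _)))

    spoiled-roomy : ∀ j → 2 * reserve (r j) ≤ # (D j) → (# (D j) + 1) * spoiled j ≤ 2 * misfits i j
    spoiled-roomy j roomy-j = begin
      (# (D j) + 1) * spoiled j                        ≡⟨ *-distribˡ-sum (# (D j) + 1) (λ x → 𝟙 (D i x ∧ spoils j x)) ⟩
      ∑[ x < n ] ((# (D j) + 1) * 𝟙 (D i x ∧ spoils j x)) ≤⟨ sum-mono-≤ n pointwise ⟩
      ∑[ x < n ] (2 * (𝟙 (D i x) * misfitsAt j x))     ≡⟨ sym (*-distribˡ-sum 2 (λ x → 𝟙 (D i x) * misfitsAt j x)) ⟩
      2 * ∑[ x < n ] (𝟙 (D i x) * misfitsAt j x)       ≤⟨ *-monoʳ-≤ 2 (misfitsAt-total j) ⟩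
      2 * misfits i j                                  ∎
      where
        open ≤-Reasoning
        pointwise : ∀ x → (# (D j) + 1) * 𝟙 (D i x ∧ spoils j x) ≤ 2 * (𝟙 (D i x) * misfitsAt j x)
        pointwise x with D i x | spoils j x in s
        ... | false | _ = ≤-trans (≤-reflexive (*-zeroʳ (# (D j) + 1))) z≤n
        ... | true | false = ≤-trans (≤-reflexive (*-zeroʳ (# (D j) + 1))) z≤n
        ... | true | true with spoils⇒unkept j x s
        ...   | r≥1 , unkept = subst₂ _≤_ (sym (*-identityʳ (# (D j) + 1))) (cong (2 *_) (sym (+-identityʳ (misfitsAt j x))))
                                  (proj₂ (unkept-misfits (misfitsAt j x) (reserve (r j)) (# (D j)) (proj₁ (sized j r≥1)) unkept) roomy-j)

    spoiled-vanish : ∀ j → (∀ x → spoils j x ≡ false) → spoiled j ≡ 0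
    spoiled-vanish j never = trans (sum-cong-≗ (λ x → trans (cong (λ b → 𝟙 (D i x ∧ b)) (never x)) (cong 𝟙 (∧-zeroʳ (D i x)))))
                                   (sum-replicate-zero n)

    spoiled-bound : ∀ j → Q * spoiled j ≤ F * N i
    spoiled-bound j with j ≟ᶠ i | r j ℕ.≟ 0
    ... | yes refl | _ = ≤-trans (≤-reflexive (trans (cong (Q *_) (spoiled-vanish i (λ x → cong (λ b → not b ∧ ((0 <ᵇ r i) ∧ not (keeps i x))) (==-refl i))))
                                                     (*-zeroʳ Q))) z≤n
    ... | no _ | yes rj = ≤-trans (≤-reflexive (trans (cong (Q *_) (spoiled-vanish j
                           (λ x → trans (cong (λ k → not (j == i) ∧ ((0 <ᵇ k) ∧ not (keeps j x))) rj) (∧-zeroʳ _))))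
                           (*-zeroʳ Q))) z≤n
    ... | no j≢i | no rj≢0 with 2 * reserve (r j) ≤ᵇ # (D j) in roomy-j
    ...   | true = ≤-trans (markov Q (spoiled j) (# (D j) + 1) 2 (8 ^ h) (misfits i j) (N i) (N j)
                              (spoiled-roomy j (≤ᵇ≡true⇒≤ roomy-j)) Nj≤ (misfits-sparse i j (j≢i ∘ sym)) (W-nonempty j))
                           (*-monoˡ-≤ (N i) (begin
                              8 ^ h * 2             ≡⟨ *-comm (8 ^ h) 2 ⟩
                              2 * 8 ^ h             ≡⟨ sym (*-identityʳ _) ⟩
                              2 * 8 ^ h * 1         ≤⟨ *-monoʳ-≤ (2 * 8 ^ h) (m^n>0 2 h) ⟩
                              F                     ∎))
      where
        open ≤-Reasoning
        size : WellSized t (D j) (r j) j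
        size = sized j (n≢0⇒n>0 rj≢0)
        Nj≤ : N j ≤ 8 ^ h * (# (D j) + 1)
        Nj≤ = ≤-trans (proj₂ size) (*-mono-≤ (^-monoʳ-≤ 8 t≤h) (m≤m+n _ 1))
    ...   | false = ≤-trans (markov Q (spoiled j) 1 1 (8 ^ h * 2 ^ h) (misfits i j) (N i) (N j)
                              (*-monoʳ-≤ 1 (spoiled≤misfits j)) Nj≤ (misfits-sparse i j (j≢i ∘ sym)) (W-nonempty j))
                           (*-monoˡ-≤ (N i) (≤-trans (≤-reflexive (*-identityʳ _)) (*-monoˡ-≤ (2 ^ h) (m≤n*m (8 ^ h) 2))))
      where
        open ≤-Reasoning
        size : WellSized t (D j) (r j) j
        size = sized j (n≢0⇒n>0 rj≢0)
        Nj≤ : N j ≤ 8 ^ h * 2 ^ h * 1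
        Nj≤ = begin
          N j              ≤⟨ proj₂ size ⟩
          8 ^ t * # (D j)  ≤⟨ *-mono-≤ (^-monoʳ-≤ 8 t≤h) (<⇒≤ (<-≤-trans (≤ᵇ≡false⇒> roomy-j) (2*reserve≤2^ (r≤h j)))) ⟩
          8 ^ h * 2 ^ h    ≡⟨ sym (*-identityʳ _) ⟩
          8 ^ h * 2 ^ h * 1 ∎

    private
      d≥1 : 1 ≤ d
      d≥1 = ≤-trans (reserve-pos (r i) r-i≥1) (proj₁ (sized i r-i≥1))

      Ni≤ : N i ≤ 8 ^ h * d
      Ni≤ = ≤-trans (proj₂ (sized i r-i≥1)) (*-monoˡ-≤ d (^-monoʳ-≤ 8 t≤h))

      P≥1 : 1 ≤ P
      P≥1 = *-mono-≤ (*-mono-≤ (≤-trans r-i≥1 (r≤h i)) (*-mono-≤ (*-mono-≤ (s≤s (z≤n {1})) (m^n>0 8 h)) (m^n>0 2 h))) (m^n>0 8 h)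

    spoiled-total : Q * ∑[ j < ℓ ] spoiled j ≤ P * d
    spoiled-total = begin
      Q * ∑[ j < ℓ ] spoiled j   ≡⟨ *-distribˡ-sum Q spoiled ⟩
      ∑[ j < ℓ ] (Q * spoiled j) ≤⟨ sum-mono-≤ ℓ spoiled-bound ⟩
      ∑[ j < ℓ ] (F * N i)       ≡⟨ sum-const ℓ (F * N i) ⟩
      ℓ * (F * N i)              ≤⟨ *-mono-≤ ℓ≤h (*-monoʳ-≤ F Ni≤) ⟩
      h * (F * (8 ^ h * d))      ≡⟨ lem h F (8 ^ h) d ⟩
      P * d                      ∎
      where
        open ≤-Reasoning
        lem : ∀ a b c e → a * (b * (c * e)) ≡ a * b * c * e
        lem = solve-∀

    high≤good+spoiled : # high ≤ # good + ∑[ j < ℓ ] spoiled j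
    high≤good+spoiled = begin
      # high                                                   ≤⟨ sum-mono-≤ n pointwise ⟩
      ∑[ x < n ] (𝟙 (good x) + ∑[ j < ℓ ] 𝟙 (D i x ∧ spoils j x)) ≡⟨ sum-+ n _ _ ⟩
      # good + ∑[ x < n ] ∑[ j < ℓ ] 𝟙 (D i x ∧ spoils j x)   ≡⟨ cong (# good +_) (sum-swap n ℓ (λ x j → 𝟙 (D i x ∧ spoils j x))) ⟩
      # good + ∑[ j < ℓ ] spoiled j                          ∎
      where
        open ≤-Reasoning
        pointwise : ∀ x → 𝟙 (high x) ≤ 𝟙 (good x) + ∑[ j < ℓ ] 𝟙 (D i x ∧ spoils j x)
        pointwise x with D i x | g ≤ᵇ outdeg (D i) x
        ... | false | _ = z≤n
        ... | true | false = z≤n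
        ... | true | true with allᶠ ℓ (λ j → not (spoils j x)) in all-kept
        ...   | true = s≤s z≤n
        ...   | false = ≤-trans (allᶠ-false ℓ _ all-kept) (≤-reflexive (sum-cong-≗ (λ j → cong 𝟙 (not-involutive (spoils j x)))))

    good-count : N i ≤ C * # good
    good-count = by-roomy roomy refl
      where
      by-roomy : ∀ b → roomy ≡ b → N i ≤ C * # good
      by-roomy true e = begin
          N i               ≤⟨ Ni≤ ⟩
          8 ^ h * d         ≤⟨ *-monoʳ-≤ (8 ^ h) d≤8G ⟩
          8 ^ h * (8 * G)   ≡⟨ lem (8 ^ h) G ⟩
          8 * 8 ^ h * 1 * G ≤⟨ *-monoˡ-≤ G (*-monoʳ-≤ (8 * 8 ^ h) (m^n>0 2 h)) ⟩
          C * G             ∎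
        where
          open ≤-Reasoning
          G B : ℕ
          G = # good
          B = ∑[ j < ℓ ] spoiled j
          lem : ∀ a b → a * (8 * b) ≡ 8 * a * 1 * b
          lem = solve-∀
          4g≤d : 4 * g ≤ d
          4g≤d = subst (λ k → 4 * k ≤ d) (sym (cong (if_then ⌊ ⌊ d /2⌋ /2⌋ else ⌊ d /2⌋) e)) (4*⌊⌊n/2⌋/2⌋≤n d)
          8B≤d : 8 * B ≤ d
          8B≤d = *-cancelˡ-≤ P {{>-nonZero P≥1}} (begin
            P * (8 * B) ≡⟨ lem′ P B ⟩
            8 * P * B   ≤⟨ *-monoˡ-≤ B (≤-trans (m≤m*n (8 * P) (2 ^ h) {{>-nonZero (m^n>0 2 h)}}) (n≤1+n _)) ⟩
            Q * B       ≤⟨ spoiled-total ⟩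
            P * d       ∎)
            where lem′ : ∀ a b → a * (8 * b) ≡ 8 * a * b
                  lem′ = solve-∀
          d≤8G : d ≤ 8 * G
          d≤8G = +-cancelʳ-≤ d d (8 * G) (begin
            d + d         ≤⟨ m≤m+n (d + d) 4 ⟩
            d + d + 4     ≡⟨ lem″ d ⟩
            2 * (d + 2)   ≤⟨ *-monoʳ-≤ 2 (highOut-large (D i) g d≥1 4g≤d) ⟩
            2 * (4 * # high) ≡⟨ sym (*-assoc 2 4 (# high)) ⟩
            8 * # high    ≤⟨ *-monoʳ-≤ 8 high≤good+spoiled ⟩
            8 * (G + B)   ≡⟨ *-distribˡ-+ 8 G B ⟩
            8 * G + 8 * B ≤⟨ +-monoʳ-≤ (8 * G) 8B≤d ⟩
            8 * G + d     ∎)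
            where lem″ : ∀ a → a + a + 4 ≡ 2 * (a + 2)
                  lem″ = solve-∀
      by-roomy false e = begin
          N i                ≤⟨ Ni≤ ⟩
          8 ^ h * d          ≤⟨ *-monoʳ-≤ (8 ^ h) (<⇒≤ d<2^h) ⟩
          8 ^ h * 2 ^ h      ≤⟨ m≤m*n (8 ^ h * 2 ^ h) G {{>-nonZero G≥1}} ⟩
          8 ^ h * 2 ^ h * G  ≤⟨ *-monoˡ-≤ G (*-monoˡ-≤ (2 ^ h) (m≤n*m (8 ^ h) 8)) ⟩
          C * G              ∎
        where
          open ≤-Reasoning
          G B : ℕ
          G = # good
          B = ∑[ j < ℓ ] spoiled j
          d<2^h : d < 2 ^ h
          d<2^h = <-≤-trans (≤ᵇ≡false⇒> e) (2*reserve≤2^ (r≤h i))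
          2g≤d : 2 * g ≤ d
          2g≤d = subst (λ k → 2 * k ≤ d) (sym (cong (if_then ⌊ ⌊ d /2⌋ /2⌋ else ⌊ d /2⌋) e)) (2*⌊n/2⌋≤n d)
          -- With few candidates, the sparse misfit count forbids any spoiled vertex.
          B≡0 : B ≡ 0
          B≡0 = n≤0⇒n≡0 (≮⇒≥ (λ B≥1 → <⇒≱ (s≤s (begin
            P * d              ≤⟨ *-monoʳ-≤ P (<⇒≤ d<2^h) ⟩
            P * 2 ^ h          ≤⟨ m≤n*m (P * 2 ^ h) 8 ⟩
            8 * (P * 2 ^ h)    ≡⟨ sym (*-assoc 8 P (2 ^ h)) ⟩
            8 * P * 2 ^ h      ∎)) (begin
            Q                  ≡⟨ sym (*-identityʳ Q) ⟩
            Q * 1              ≤⟨ *-monoʳ-≤ Q B≥1 ⟩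
            Q * B              ≤⟨ spoiled-total ⟩
            P * d              ∎)))
          G≥1 : 1 ≤ G
          G≥1 = ≤-trans (highOut-nonempty (D i) g d≥1 2g≤d)
                  (≤-trans high≤good+spoiled (≤-reflexive (trans (cong (G +_) B≡0) (+-identityʳ G))))

    #restrict+misfitsAt : ∀ x j → # (restrict x j) + misfitsAt j x ≡ # (D j)
    #restrict+misfitsAt x j = #-split (D j) (fits i x j)

    #restrict-own : ∀ x → # (restrict x i) ≡ outdeg (D i) x
    #restrict-own x = sum-cong-≗ (λ y → cong (λ b → 𝟙 (D i y ∧ b)) (fits-inside i x y))

    good⇒high : ∀ x → good x ≡ true → high x ≡ true
    good⇒high x e = proj₁ (∧≡true e)

    good⇒candidate : ∀ x → good x ≡ true → D i x ≡ true
    good⇒candidate x e = proj₁ (∧≡true (good⇒high x e))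

    good⇒kept : ∀ x → good x ≡ true → ∀ j → j ≢ i → 1 ≤ r j → keeps j x ≡ true
    good⇒kept x e j j≢i r≥1 = kept (allᶠ-true ℓ _ (proj₂ (∧≡true e)) j)
      where
        kept : not (spoils j x) ≡ true → keeps j x ≡ true
        kept unspoiled with j == i in j=i | r j | keeps j x
        ... | true | _ | _ = ⊥-elim (j≢i (==⇒≡ j i j=i))
        ... | false | suc _ | true = refl

    restrict-other : ∀ x → good x ≡ true → ∀ j → j ≢ i → 1 ≤ r j → WellSized (suc t) (restrict x j) (r j) j
    restrict-other x e j j≢i r≥1 = reserve≤ , N≤
      where
        open ≤-Reasoning
        m c′ : ℕ
        m = misfitsAt j x
        c′ = # (restrict x j)
        split : c′ + m ≡ # (D j)
        split = #restrict+misfitsAt x j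
        kept : (2 * m ≤ᵇ # (D j)) ≡ true × (m + reserve (r j) ≤ᵇ # (D j)) ≡ true
        kept = ∧≡true (good⇒kept x e j j≢i r≥1)
        reserve≤ : reserve (r j) ≤ c′
        reserve≤ = +-cancelˡ-≤ m _ _ (begin
          m + reserve (r j) ≤⟨ ≤ᵇ≡true⇒≤ (proj₂ kept) ⟩
          # (D j)           ≡⟨ sym split ⟩
          c′ + m            ≡⟨ +-comm c′ m ⟩
          m + c′            ∎)
        c≤2c′ : # (D j) ≤ 2 * c′
        c≤2c′ = +-cancelʳ-≤ (2 * m) _ _ (begin
          # (D j) + 2 * m         ≤⟨ +-monoʳ-≤ (# (D j)) (≤ᵇ≡true⇒≤ (proj₁ kept)) ⟩
          # (D j) + # (D j)       ≡⟨ cong₂ _+_ (sym split) (sym split) ⟩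
          (c′ + m) + (c′ + m)     ≡⟨ lem c′ m ⟩
          2 * c′ + 2 * m          ∎)
          where lem : ∀ a b → (a + b) + (a + b) ≡ 2 * a + 2 * b
                lem = solve-∀
        N≤ : N j ≤ 8 ^ suc t * c′
        N≤ = begin
          N j                  ≤⟨ proj₂ (sized j r≥1) ⟩
          8 ^ t * # (D j)      ≤⟨ *-monoʳ-≤ (8 ^ t) c≤2c′ ⟩
          8 ^ t * (2 * c′)     ≤⟨ *-monoʳ-≤ (8 ^ t) (*-monoˡ-≤ c′ (s≤s (s≤s (z≤n {6})))) ⟩
          8 ^ t * (8 * c′)     ≡⟨ lem (8 ^ t) c′ ⟩
          8 ^ suc t * c′       ∎
          where lem : ∀ a b → a * (8 * b) ≡ 8 * a * b
                lem = solve-∀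

    threshold-bounds : ∀ a → 1 ≤ a → reserve (r i) ≡ 2 * a → a ≤ g × d ≤ 8 * g
    threshold-bounds a a≥1 reserve≡ = by-roomy roomy refl
      where
        2a≤d : 2 * a ≤ d
        2a≤d = subst (_≤ d) reserve≡ (proj₁ (sized i r-i≥1))
        by-roomy : ∀ b → roomy ≡ b → a ≤ g × d ≤ 8 * g
        by-roomy true e = subst (λ k → a ≤ k × d ≤ 8 * k) (sym (cong (if_then ⌊ ⌊ d /2⌋ /2⌋ else ⌊ d /2⌋) e))
                            (quarter-bounds a d a≥1 (≤-trans (≤-reflexive (trans (*-assoc 2 2 a) (cong (2 *_) (sym reserve≡))))
                                                             (≤ᵇ≡true⇒≤ e)))
        by-roomy false e = subst (λ k → a ≤ k × d ≤ 8 * k) (sym (cong (if_then ⌊ ⌊ d /2⌋ /2⌋ else ⌊ d /2⌋) e))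
                             (half-bounds a d a≥1 2a≤d)

    restrict-own : ∀ x → good x ≡ true → ∀ r′ → r i ≡ suc r′ → 1 ≤ r′ → WellSized (suc t) (restrict x i) r′ i
    restrict-own x e r′ r≡ r′≥1 = ≤-trans a≤g g≤c′ , (begin
        N i                 ≤⟨ proj₂ (sized i r-i≥1) ⟩
        8 ^ t * d           ≤⟨ *-monoʳ-≤ (8 ^ t) d≤8g ⟩
        8 ^ t * (8 * g)     ≤⟨ *-monoʳ-≤ (8 ^ t) (*-monoʳ-≤ 8 g≤c′) ⟩
        8 ^ t * (8 * c′)    ≡⟨ lem (8 ^ t) c′ ⟩
        8 ^ suc t * c′      ∎)
      where
        open ≤-Reasoning
        lem : ∀ a b → a * (8 * b) ≡ 8 * a * b
        lem = solve-∀
        c′ : ℕ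
        c′ = # (restrict x i)
        g≤c′ : g ≤ c′
        g≤c′ = subst (g ≤_) (sym (#restrict-own x)) (≤ᵇ≡true⇒≤ (proj₂ (∧≡true (good⇒high x e))))
        bounds : reserve r′ ≤ g × d ≤ 8 * g
        bounds = threshold-bounds (reserve r′) (reserve-pos r′ r′≥1) (trans (cong reserve r≡) (reserve-suc r′ r′≥1))
        a≤g : reserve r′ ≤ g
        a≤g = proj₁ bounds
        d≤8g : d ≤ 8 * g
        d≤8g = proj₂ bounds

witness : ∀ {n} (D : Fin n → Bool) → 1 ≤ # D → Fin n
witness {suc _} _ _ = zero

AllPairs-lookup : ∀ {A : Set} {R : A → A → Set} {xs : List A} → AllPairs R xs →
                  ∀ k k′ → toℕ k < toℕ k′ → R (lookup xs k) (lookup xs k′)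
AllPairs-lookup (px ∷ pxs) zero (suc k′) _ = All.lookup px (∈-lookup k′)
AllPairs-lookup (px ∷ pxs) (suc k) (suc k′) (s≤s k<k′) = AllPairs-lookup pxs k k′ k<k′

SameImage : ∀ {h n} {H : Digraph h} {T : Digraph n} → Embedding H T → Embedding H T → Set
SameImage {h} f g = ((a : Fin h) → ∃ λ b → emb f a ≡ emb g b) × ((b : Fin h) → ∃ λ a → emb f a ≡ emb g b)

SameImage-sym : ∀ {h n} {H : Digraph h} {T : Digraph n} {f g : Embedding H T} → SameImage f g → SameImage g f
SameImage-sym (f⊆g , g⊆f) = (λ b → let a , e = g⊆f b in a , sym e) , (λ a → let b , e = f⊆g a in b , sym e)

-- The tree of greedy embeddings

prod : (m : ℕ) → (Fin m → ℕ) → ℕ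
prod zero f = 1
prod (suc m) f = f zero * prod m (f ∘ suc)

prodFin≡prod : ∀ m f → prodFin m f ≡ prod m f
prodFin≡prod m f = go m (λ k → k)
  where go : ∀ k (g : Fin k → Fin m) → foldr (λ i acc → f i * acc) 1 (tabulate g) ≡ prod k (f ∘ g)
        go zero g = refl
        go (suc k) g = cong (f (g zero) *_) (go k (g ∘ suc))

prod-cong : ∀ m {f g : Fin m → ℕ} → (∀ i → f i ≡ g i) → prod m f ≡ prod m g
prod-cong zero _ = refl
prod-cong (suc m) f≗g = cong₂ _*_ (f≗g zero) (prod-cong m (f≗g ∘ suc))

prodFin-cong : ∀ m {f g : Fin m → ℕ} → (∀ i → f i ≡ g i) → prodFin m f ≡ prodFin m g
prodFin-cong m f≗g = trans (prodFin≡prod m _) (trans (prod-cong m f≗g) (sym (prodFin≡prod m _)))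

prod-* : ∀ m (f g : Fin m → ℕ) → prod m (λ i → f i * g i) ≡ prod m f * prod m g
prod-* zero f g = refl
prod-* (suc m) f g rewrite prod-* m (f ∘ suc) (g ∘ suc) = lem (f zero) (g zero) _ _
  where lem : ∀ a b c d → a * b * (c * d) ≡ a * c * (b * d)
        lem = solve-∀

prod-1 : ∀ m → prod m (λ _ → 1) ≡ 1
prod-1 zero = refl
prod-1 (suc m) = trans (+-identityʳ _) (prod-1 m)

prod-^𝟙 : ∀ m (f : Fin m → ℕ) p → prod m (λ i → f i ^ 𝟙 (p == i)) ≡ f p
prod-^𝟙 (suc m) f zero = trans (cong (f zero * 1 *_) (prod-1 m)) (trans (*-identityʳ _) (*-identityʳ _))
prod-^𝟙 (suc m) f (suc p) = trans (+-identityʳ _) (prod-^𝟙 m (f ∘ suc) p)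

module GreedyEmbedding {n : ℕ} (T : Digraph n) (tour : IsTournament T)
                       {h ℓ : ℕ} (H : Digraph h) (H-irrefl : ∀ a → H a a ≡ false)
                       (ℓ≤h : ℓ ≤ h) (part : Fin h → Fin ℓ)
                       (W : Fin ℓ → Fin n → Bool)
                       (W-disjoint : ∀ i j x → W i x ≡ true → W j x ≡ true → i ≡ j)
                       (dir : Fin ℓ → Fin ℓ → Bool)
                       (dir-refl : ∀ i → dir i i ≡ true)
                       (dir-flip : ∀ i j → i ≢ j → dir i j ≡ not (dir j i))
                       (dir-arrow : ∀ i j → i ≢ j → dir i j ≡ true → PartArrow H part i j)
                       (back-sparse : ∀ i j → i ≢ j → dir i j ≡ true →
                                      sparsity h * backPairs T (W i) (W j) ≤ # (W i) * # (W j))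
                       (W-nonempty : ∀ i → 1 ≤ # (W i)) where

  open import Data.List.Membership.Propositional using (_∈_)
  open Candidates T tour ℓ≤h W dir dir-refl dir-flip back-sparse W-nonempty

  remaining : Fin ℓ → List (Fin h) → ℕ
  remaining j [] = 0
  remaining j (v ∷ L) = 𝟙 (part v == j) + remaining j L

  remaining≤length : ∀ j L → remaining j L ≤ length L
  remaining≤length j [] = z≤n
  remaining≤length j (v ∷ L) = +-mono-≤ (𝟙≤1 (part v == j)) (remaining≤length j L)

  ∏N : List (Fin h) → ℕ
  ∏N [] = 1
  ∏N (v ∷ L) = N (part v) * ∏N L

  Placed : Set
  Placed = Σ (Embedding H T) λ f → ∀ a → W (part a) (emb f a) ≡ true

  Distinct : Placed → Placed → Set
  Distinct f g = ¬ SameImage (proj₁ f) (proj₁ g)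

  -- The state after embedding the vertices done (by ρ), with the vertices seq still to come,
  -- the candidate sets D, and t steps taken.
  record Invariant (done seq : List (Fin h)) (ρ : Fin h → Fin n) (D : Fin ℓ → Fin n → Bool) (t : ℕ) : Set where
    field
      steps : t + length seq ≡ h
      cover : ∀ b → b ∈ done ⊎ b ∈ seq
      ordered : AllPairs (Precedes H part) seq
      done-first : ∀ a b → a ∈ done → b ∈ seq → Precedes H part a b
      D⊆W : ∀ j y → D j y ≡ true → W j y ≡ true
      fitting : ∀ a → a ∈ done → ∀ j y → D j y ≡ true → fits (part a) (ρ a) j y ≡ true
      ρ∈W : ∀ a → a ∈ done → W (part a) (ρ a) ≡ true
      ρ-injective : ∀ a b → a ∈ done → b ∈ done → ρ a ≡ ρ b → a ≡ b
      ρ-edge : ∀ a b → a ∈ done → b ∈ done → H a b ≡ true → T (ρ a) (ρ b) ≡ true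
      sized : ∀ j → 1 ≤ remaining j seq → WellSized t (D j) (remaining j seq) j

  record Extensions (done seq : List (Fin h)) (ρ : Fin h → Fin n) (D : Fin ℓ → Fin n → Bool) : Set where
    field
      leaves : List Placed
      extends : ∀ f → f ∈ leaves → ∀ a → a ∈ done → emb (proj₁ f) a ≡ ρ a
      in-D : ∀ f → f ∈ leaves → ∀ b → b ∈ seq → D (part b) (emb (proj₁ f) b) ≡ true
      distinct : AllPairs Distinct leaves
      many : ∏N seq ≤ branchLoss h ^ length seq * length leaves

  finished : ∀ {done ρ D t} → Invariant done [] ρ D t → Extensions done [] ρ D
  finished {done} {ρ} I = record
    { leaves = (f , λ a → ρ∈W a (all-done a)) ∷ []
    ; extends = λ { _ (here refl) a _ → refl }
    ; in-D = λ _ _ _ ()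
    ; distinct = All.[] ∷ []
    ; many = s≤s z≤n }
    where
      open Invariant I
      all-done : ∀ a → a ∈ done
      all-done a with cover a
      ... | inj₁ a∈ = a∈
      f : Embedding H T
      f = record { emb = ρ
                 ; inj = λ {a} {b} → ρ-injective a b (all-done a) (all-done b)
                 ; edges = λ a b → ρ-edge a b (all-done a) (all-done b) }

  module Branching (done tail : List (Fin h)) (v : Fin h) (ρ : Fin h → Fin n)
                   (cover : ∀ b → b ∈ done ⊎ b ∈ v ∷ tail) where

    Extends Dominates : Placed → Set
    Extends f = ∀ a → a ∈ done → emb (proj₁ f) a ≡ ρ a
    Dominates f = ∀ b → b ∈ tail → part b ≡ part v → T (emb (proj₁ f) v) (emb (proj₁ f) b) ≡ true

    private
      dominated : ∀ f g → Extends f → Extends g → Dominates g → emb (proj₁ f) v ≢ emb (proj₁ g) v →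
                  ∀ b → emb (proj₁ f) v ≡ emb (proj₁ g) b → T (emb (proj₁ g) v) (emb (proj₁ f) v) ≡ true
      dominated f g f-ext g-ext g-dom f≢g b fv≡gb with b ≟ᶠ v
      ... | yes refl = ⊥-elim (f≢g fv≡gb)
      ... | no b≢v with cover b
      ...   | inj₁ b∈done = ⊥-elim (b≢v (sym (inj (proj₁ f) (trans fv≡gb (trans (g-ext b b∈done) (sym (f-ext b b∈done)))))))
      ...   | inj₂ (here b≡v) = ⊥-elim (b≢v b≡v)
      ...   | inj₂ (there b∈tail) = subst (λ z → T (emb (proj₁ g) v) z ≡ true) (sym fv≡gb) (g-dom b b∈tail same-part)
        where same-part : part b ≡ part v
              same-part = W-disjoint (part b) (part v) (emb (proj₁ g) b) (proj₂ g b)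
                            (subst (λ z → W (part v) z ≡ true) fv≡gb (proj₂ f v))

    distinct-at : ∀ f g → Extends f → Extends g → Dominates f → Dominates g →
                  emb (proj₁ f) v ≢ emb (proj₁ g) v → Distinct f g
    distinct-at f g f-ext g-ext f-dom g-dom f≢g (f⊆g , g⊆f) =
      case trans (sym f→g) (trans (proj₂ tour _ _ f≢g) (cong not g→f)) of λ ()
      where
        g→f : T (emb (proj₁ g) v) (emb (proj₁ f) v) ≡ true
        g→f = dominated f g f-ext g-ext g-dom f≢g (proj₁ (f⊆g v)) (proj₂ (f⊆g v))
        f→g : T (emb (proj₁ f) v) (emb (proj₁ g) v) ≡ true
        f→g = dominated g f g-ext f-ext f-dom (f≢g ∘ sym) (proj₁ (g⊆f v)) (sym (proj₂ (g⊆f v)))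

  _[_↦_] : (Fin h → Fin n) → Fin h → Fin n → Fin h → Fin n
  (ρ [ v ↦ x ]) a = if a == v then x else ρ a

  ↦-here : ∀ ρ v x → (ρ [ v ↦ x ]) v ≡ x
  ↦-here ρ v x rewrite ==-refl v = refl

  ↦-there : ∀ ρ v x a → a ≢ v → (ρ [ v ↦ x ]) a ≡ ρ a
  ↦-there ρ v x a a≢v with a == v in e
  ... | true = ⊥-elim (a≢v (==⇒≡ a v e))
  ... | false = refl

  module Advance (done : List (Fin h)) (v : Fin h) (tail : List (Fin h)) (ρ : Fin h → Fin n)
                 (D : Fin ℓ → Fin n → Bool) (t : ℕ) (I : Invariant done (v ∷ tail) ρ D t) where

    open Invariant I
    i : Fin ℓ
    i = part v

    remaining-own : remaining i (v ∷ tail) ≡ suc (remaining i tail)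
    remaining-own rewrite ==-refl i = refl

    remaining-other : ∀ j → j ≢ i → remaining j (v ∷ tail) ≡ remaining j tail
    remaining-other j j≢i with part v == j in e
    ... | true = ⊥-elim (j≢i (sym (==⇒≡ (part v) j e)))
    ... | false = refl

    t≤h : t ≤ h
    t≤h = subst (t ≤_) steps (m≤m+n t _)

    remaining≤h : ∀ j → remaining j (v ∷ tail) ≤ h
    remaining≤h j = ≤-trans (remaining≤length j (v ∷ tail)) (subst (length (v ∷ tail) ≤_) steps (m≤n+m _ t))

    open Step D D⊆W (λ j → remaining j (v ∷ tail)) remaining≤h t t≤h sized i
                (subst (1 ≤_) (sym remaining-own) (s≤s z≤n)) public

    restrict⇒D : ∀ x j y → restrict x j y ≡ true → D j y ≡ true
    restrict⇒D x j y e = proj₁ (∧≡true e)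

    restrict⇒fits : ∀ x j y → restrict x j y ≡ true → fits i x j y ≡ true
    restrict⇒fits x j y e = proj₂ (∧≡true e)

    open Branching done tail v ρ cover public

    #good-in : List (Fin n) → ℕ
    #good-in [] = 0
    #good-in (x ∷ L) = 𝟙 (good x) + #good-in L

    #good-in-allFin : #good-in (allFin n) ≡ # good
    #good-in-allFin = go n (λ k → k)
      where go : ∀ m (f : Fin m → Fin n) → #good-in (tabulate f) ≡ ∑[ k < m ] 𝟙 (good (f k))
            go zero f = refl
            go (suc m) f = cong (𝟙 (good (f zero)) +_) (go m (f ∘ suc))

    record Branches (L : List (Fin n)) : Set where
      field
        leaves : List Placed
        extends : ∀ f → f ∈ leaves → Extends f
        in-D : ∀ f → f ∈ leaves → ∀ b → b ∈ v ∷ tail → D (part b) (emb (proj₁ f) b) ≡ true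
        dominates : ∀ f → f ∈ leaves → Dominates f
        image-in : ∀ f → f ∈ leaves → emb (proj₁ f) v ∈ L
        distinct : AllPairs Distinct leaves
        many : #good-in L * ∏N tail ≤ branchLoss h ^ length tail * length leaves

    v∉done : ∀ a → a ∈ done → a ≢ v
    v∉done a a∈ = proj₁ (done-first a v a∈ (here refl))

    module _ (x : Fin n) (good-x : good x ≡ true) where

      private
        ρ′ : Fin h → Fin n
        ρ′ = ρ [ v ↦ x ]
        ρ′-done : ∀ a → a ∈ done → ρ′ a ≡ ρ a
        ρ′-done a a∈ = ↦-there ρ v x a (v∉done a a∈)
        x∈D : D i x ≡ true
        x∈D = good⇒candidate x good-x

        fits-x : ∀ a → a ∈ done → fits (part a) (ρ a) i x ≡ true
        fits-x a a∈ = fitting a a∈ i x x∈D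

      ρ≢x : ∀ b → b ∈ done → ρ b ≢ x
      ρ≢x b b∈ ρb≡x = case trans (sym (fits-x b b∈)) (subst (λ z → fits (part b) z i x ≡ false) (sym ρb≡x) (fits-irrefl (part b) x i)) of λ ()

      edge-out : ∀ b → b ∈ done → H v b ≡ true → T x (ρ b) ≡ true
      edge-out b b∈ Hvb with dir (part b) i in e
      ... | false = subst (_≡ true) (cong (λ z → if z then T (ρ b) x else T x (ρ b)) e) (fits-x b b∈)
      ... | true with part b ≟ᶠ i
      ...   | yes pb≡i = case trans (sym Hvb) (proj₂ (done-first b v b∈ (here refl)) pb≡i) of λ ()
      ...   | no pb≢i = case trans (sym Hvb) (dir-arrow (part b) i pb≢i e b v refl refl) of λ ()

      edge-in : ∀ a → a ∈ done → H a v ≡ true → T (ρ a) x ≡ true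
      edge-in a a∈ Hav with dir (part a) i in e
      ... | true = subst (_≡ true) (cong (λ z → if z then T (ρ a) x else T x (ρ a)) e) (fits-x a a∈)
      ... | false = case trans (sym Hav) (dir-arrow i (part a) i≢pa (trans (dir-flip i (part a) i≢pa) (cong not e)) v a refl refl) of λ ()
        where i≢pa : i ≢ part a
              i≢pa i≡pa = case trans (sym (dir-refl (part a))) (trans (cong (λ k → dir (part a) k) (sym i≡pa)) e) of λ ()

      next : Invariant (v ∷ done) tail ρ′ (restrict x) (suc t)
      next = record
        { steps = trans (sym (+-suc t (length tail))) steps
        ; cover = cover′
        ; ordered = AllPairs.tail ordered
        ; done-first = done-first′
        ; D⊆W = λ j y e → D⊆W j y (restrict⇒D x j y e)
        ; fitting = fitting′
        ; ρ∈W = ρ∈W′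
        ; ρ-injective = injective′
        ; ρ-edge = edge′
        ; sized = sized′ }
        where
          cover′ : ∀ b → b ∈ v ∷ done ⊎ b ∈ tail
          cover′ b with cover b
          ... | inj₁ b∈ = inj₁ (there b∈)
          ... | inj₂ (here b≡v) = inj₁ (here b≡v)
          ... | inj₂ (there b∈) = inj₂ b∈
          done-first′ : ∀ a b → a ∈ v ∷ done → b ∈ tail → Precedes H part a b
          done-first′ a b (here refl) b∈ = All.lookup (AllPairs.head ordered) b∈
          done-first′ a b (there a∈) b∈ = done-first a b a∈ (there b∈)
          fitting′ : ∀ a → a ∈ v ∷ done → ∀ j y → restrict x j y ≡ true → fits (part a) (ρ′ a) j y ≡ true
          fitting′ a (here refl) j y e = subst (λ z → fits i z j y ≡ true) (sym (↦-here ρ v x)) (restrict⇒fits x j y e)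
          fitting′ a (there a∈) j y e = subst (λ z → fits (part a) z j y ≡ true) (sym (ρ′-done a a∈)) (fitting a a∈ j y (restrict⇒D x j y e))
          ρ∈W′ : ∀ a → a ∈ v ∷ done → W (part a) (ρ′ a) ≡ true
          ρ∈W′ a (here refl) = subst (λ z → W i z ≡ true) (sym (↦-here ρ v x)) (D⊆W i x x∈D)
          ρ∈W′ a (there a∈) = subst (λ z → W (part a) z ≡ true) (sym (ρ′-done a a∈)) (ρ∈W a a∈)
          injective′ : ∀ a b → a ∈ v ∷ done → b ∈ v ∷ done → ρ′ a ≡ ρ′ b → a ≡ b
          injective′ a b (here refl) (here refl) _ = refl
          injective′ a b (here refl) (there b∈) e = ⊥-elim (ρ≢x b b∈ (trans (sym (ρ′-done b b∈)) (trans (sym e) (↦-here ρ v x))))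
          injective′ a b (there a∈) (here refl) e = ⊥-elim (ρ≢x a a∈ (trans (sym (ρ′-done a a∈)) (trans e (↦-here ρ v x))))
          injective′ a b (there a∈) (there b∈) e = ρ-injective a b a∈ b∈ (trans (sym (ρ′-done a a∈)) (trans e (ρ′-done b b∈)))
          edge′ : ∀ a b → a ∈ v ∷ done → b ∈ v ∷ done → H a b ≡ true → T (ρ′ a) (ρ′ b) ≡ true
          edge′ a b (here refl) (here refl) e = case trans (sym e) (H-irrefl a) of λ ()
          edge′ a b (here refl) (there b∈) e = subst₂ (λ z w → T z w ≡ true) (sym (↦-here ρ v x)) (sym (ρ′-done b b∈)) (edge-out b b∈ e)
          edge′ a b (there a∈) (here refl) e = subst₂ (λ z w → T z w ≡ true) (sym (ρ′-done a a∈)) (sym (↦-here ρ v x)) (edge-in a a∈ e)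
          edge′ a b (there a∈) (there b∈) e = subst₂ (λ z w → T z w ≡ true) (sym (ρ′-done a a∈)) (sym (ρ′-done b b∈)) (ρ-edge a b a∈ b∈ e)
          sized′ : ∀ j → 1 ≤ remaining j tail → WellSized (suc t) (restrict x j) (remaining j tail) j
          sized′ j r≥1 with j ≟ᶠ i
          ... | yes refl = restrict-own x good-x (remaining i tail) remaining-own r≥1
          ... | no j≢i = subst (λ k → WellSized (suc t) (restrict x j) k j) (remaining-other j j≢i)
                           (restrict-other x good-x j j≢i (subst (1 ≤_) (sym (remaining-other j j≢i)) r≥1))

    module Grow (child : ∀ x → good x ≡ true → Extensions (v ∷ done) tail (ρ [ v ↦ x ]) (restrict x)) where

      private
        C : ℕ
        C = branchLoss h

      none : Branches []
      none = record
        { leaves = [] ; extends = λ _ () ; in-D = λ _ () ; dominates = λ _ () ; image-in = λ _ ()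
        ; distinct = [] ; many = z≤n }

      skip : ∀ x {L} → good x ≡ false → Branches L → Branches (x ∷ L)
      skip x {L} bad rest = record
        { leaves = leaves ; extends = extends ; in-D = in-D ; dominates = dominates
        ; image-in = λ f f∈ → there (image-in f f∈) ; distinct = distinct
        ; many = subst (λ b → (𝟙 b + #good-in L) * ∏N tail ≤ C ^ length tail * length leaves) (sym bad) many }
        where open Branches rest

      take : ∀ x {L} → All.All (x ≢_) L → good x ≡ true → Branches L → Branches (x ∷ L)
      take x {L} x∉L good-x rest = record
        { leaves = new ++ R.leaves
        ; extends = λ f f∈ → [ extends-new f , R.extends f ]′ (∈-++⁻ new f∈)
        ; in-D = λ f f∈ → [ in-D-new f , R.in-D f ]′ (∈-++⁻ new f∈)
        ; dominates = λ f f∈ → [ dominates-new f , R.dominates f ]′ (∈-++⁻ new f∈)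
        ; image-in = λ f f∈ → [ (λ f∈new → here (v↦x f f∈new)) , there ∘ R.image-in f ]′ (∈-++⁻ new f∈)
        ; distinct = AllPairsₚ.++⁺ (Extensions.distinct sub) R.distinct
                       (All.tabulate λ {f} f∈ → All.tabulate λ {g} g∈ →
                          distinct-at f g (extends-new f f∈) (R.extends g g∈) (dominates-new f f∈) (R.dominates g g∈)
                            (λ fv≡gv → All.lookup x∉L (R.image-in g g∈) (trans (sym (v↦x f f∈)) fv≡gv)))
        ; many = subst (λ b → (𝟙 b + #good-in L) * ∏N tail ≤ C ^ length tail * length (new ++ R.leaves)) (sym good-x) (begin
            (1 + #good-in L) * ∏N tail                   ≡⟨ *-distribʳ-+ (∏N tail) 1 (#good-in L) ⟩
            1 * ∏N tail + #good-in L * ∏N tail           ≤⟨ +-mono-≤ (≤-trans (≤-reflexive (*-identityˡ _)) (Extensions.many sub)) R.many ⟩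
            C ^ length tail * length new + C ^ length tail * length R.leaves ≡⟨ sym (*-distribˡ-+ (C ^ length tail) _ _) ⟩
            C ^ length tail * (length new + length R.leaves) ≡⟨ cong (C ^ length tail *_) (sym (length-++ new)) ⟩
            C ^ length tail * length (new ++ R.leaves)   ∎) }
        where
          open ≤-Reasoning
          module R = Branches rest
          sub : Extensions (v ∷ done) tail (ρ [ v ↦ x ]) (restrict x)
          sub = child x good-x
          new : List Placed
          new = Extensions.leaves sub
          v↦x : ∀ f → f ∈ new → emb (proj₁ f) v ≡ x
          v↦x f f∈ = trans (Extensions.extends sub f f∈ v (here refl)) (↦-here ρ v x)
          extends-new : ∀ f → f ∈ new → Extends f
          extends-new f f∈ a a∈ = trans (Extensions.extends sub f f∈ a (there a∈)) (↦-there ρ v x a (v∉done a a∈))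
          in-D-new : ∀ f → f ∈ new → ∀ b → b ∈ v ∷ tail → D (part b) (emb (proj₁ f) b) ≡ true
          in-D-new f f∈ b (here refl) = subst (λ z → D i z ≡ true) (sym (v↦x f f∈)) (good⇒candidate x good-x)
          in-D-new f f∈ b (there b∈) = restrict⇒D x (part b) _ (Extensions.in-D sub f f∈ b b∈)
          dominates-new : ∀ f → f ∈ new → Dominates f
          dominates-new f f∈ b b∈ pb≡pv = subst (λ z → T z (emb (proj₁ f) b) ≡ true) (sym (v↦x f f∈))
            (trans (sym (fits-inside i x (emb (proj₁ f) b)))
              (subst (λ k → fits i x k (emb (proj₁ f) b) ≡ true) pb≡pv
                (restrict⇒fits x (part b) (emb (proj₁ f) b) (Extensions.in-D sub f f∈ b b∈))))

      collect : (L : List (Fin n)) → Unique L → Branches L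
      collect [] _ = none
      collect (x ∷ L) (x∉L ∷ uniq) with good x in good-x
      ... | true = take x x∉L good-x (collect L uniq)
      ... | false = skip x good-x (collect L uniq)

      grown : Extensions done (v ∷ tail) ρ D
      grown = record { leaves = leaves ; extends = extends ; in-D = in-D ; distinct = distinct ; many = many′ }
        where
          open Branches (collect (allFin n) (allFin⁺ n))
          open ≤-Reasoning
          many′ : ∏N (v ∷ tail) ≤ C ^ length (v ∷ tail) * length leaves
          many′ = begin
            N i * ∏N tail                           ≤⟨ *-monoˡ-≤ (∏N tail) good-count ⟩
            C * # good * ∏N tail                    ≡⟨ *-assoc C (# good) (∏N tail) ⟩
            C * (# good * ∏N tail)                  ≡⟨ cong (λ z → C * (z * ∏N tail)) (sym #good-in-allFin) ⟩
            C * (#good-in (allFin n) * ∏N tail)     ≤⟨ *-monoʳ-≤ C many ⟩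
            C * (C ^ length tail * length leaves)   ≡⟨ sym (*-assoc C _ _) ⟩
            C ^ length (v ∷ tail) * length leaves   ∎

  extensions : ∀ seq done ρ D t → Invariant done seq ρ D t → Extensions done seq ρ D
  extensions [] done ρ D t I = finished I
  extensions (v ∷ tail) done ρ D t I = grown
    where open Advance done v tail ρ D t I
          open Grow (λ x good-x → extensions tail (v ∷ done) (ρ [ v ↦ x ]) (restrict x) (suc t) (next x good-x))

  ∏N≡prod : ∀ L → ∏N L ≡ prod ℓ (λ i → N i ^ remaining i L)
  ∏N≡prod [] = sym (prod-1 ℓ)
  ∏N≡prod (v ∷ L) = begin
    N (part v) * ∏N L                                                ≡⟨ cong₂ _*_ (sym (prod-^𝟙 ℓ N (part v))) (∏N≡prod L) ⟩
    prod ℓ (λ i → N i ^ 𝟙 (part v == i)) * prod ℓ (λ i → N i ^ remaining i L) ≡⟨ sym (prod-* ℓ _ _) ⟩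
    prod ℓ (λ i → N i ^ 𝟙 (part v == i) * N i ^ remaining i L)        ≡⟨ prod-cong ℓ (λ i → sym (^-distribˡ-+-* (N i) (𝟙 (part v == i)) (remaining i L))) ⟩
    prod ℓ (λ i → N i ^ remaining i (v ∷ L))                          ∎
    where open ≡-Reasoning

  remaining≡partSize : ∀ {L} → L ↭ allFin h → ∀ i → remaining i L ≡ partSize part i
  remaining≡partSize {L} L↭ i = trans (as-sum L) (sum-↭ (map⁺ (λ v → 𝟙 (part v == i)) L↭))
    where as-sum : ∀ L → remaining i L ≡ List.sum (map (λ v → 𝟙 (part v == i)) L)
          as-sum [] = refl
          as-sum (v ∷ L) = cong (𝟙 (part v == i) +_) (as-sum L)

  many-copies : (∀ i → PartAcyclic H part i) → (∀ i → 2 ^ (h ∸ 1) ≤ N i) →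
                Σ ℕ λ m → AtLeastCopies H T m × prodFin ℓ (λ i → N i ^ partSize part i) ≤ branchLoss h ^ h * m
  many-copies acyclic W-large = length leaves , (copy , copy-distinct) , bound
    where
      open TopologicalOrder H part acyclic using (topologicalSort)
      sorted : Σ (List (Fin h)) λ S → S ↭ allFin h × AllPairs (Precedes H part) S
      sorted = topologicalSort h (allFin h) (length-tabulate (λ k → k)) (allFin⁺ h)
      seq : List (Fin h)
      seq = proj₁ sorted
      seq↭ : seq ↭ allFin h
      seq↭ = proj₁ (proj₂ sorted)
      length-seq : length seq ≡ h
      length-seq = trans (↭-length seq↭) (length-tabulate (λ k → k))

      some-vertex : Fin h → Fin n
      some-vertex a = witness (W (part a)) (W-nonempty (part a))

      start : Invariant [] seq some-vertex W 0
      start = record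
        { steps = length-seq
        ; cover = λ b → inj₂ (∈-resp-↭ (↭-sym seq↭) (∈-allFin b))
        ; ordered = proj₂ (proj₂ sorted)
        ; done-first = λ _ _ ()
        ; D⊆W = λ _ _ e → e
        ; fitting = λ _ ()
        ; ρ∈W = λ _ ()
        ; ρ-injective = λ _ _ ()
        ; ρ-edge = λ _ _ ()
        ; sized = λ j _ → ≤-trans (reserve≤ (≤-trans (remaining≤length j seq) (≤-reflexive length-seq))) (W-large j)
                        , ≤-reflexive (sym (*-identityˡ (N j))) }
        where reserve≤ : ∀ {r} → r ≤ h → reserve r ≤ 2 ^ (h ∸ 1)
              reserve≤ {zero} _ = z≤n
              reserve≤ {suc r} (s≤s r≤h) = ^-monoʳ-≤ 2 r≤h

      open Extensions (extensions seq [] some-vertex W 0 start)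

      copy : Fin (length leaves) → Embedding H T
      copy k = proj₁ (lookup leaves k)

      copy-distinct : ∀ k k′ → k ≢ k′ → ¬ SameCopy (copy k) (copy k′)
      copy-distinct k k′ k≢k′ (f⊆g , g⊆f , _) with <-cmp (toℕ k) (toℕ k′)
      ... | tri< k<k′ _ _ = AllPairs-lookup distinct k k′ k<k′ (f⊆g , g⊆f)
      ... | tri≈ _ k≡k′ _ = k≢k′ (toℕ-injective k≡k′)
      ... | tri> _ _ k′<k = AllPairs-lookup distinct k′ k k′<k (SameImage-sym {f = copy k} {g = copy k′} (f⊆g , g⊆f))

      bound : prodFin ℓ (λ i → N i ^ partSize part i) ≤ branchLoss h ^ h * length leaves
      bound = subst₂ _≤_ (trans (∏N≡prod seq) (trans (prod-cong ℓ (λ i → cong (N i ^_) (remaining≡partSize seq↭ i)))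
                                                        (sym (prodFin≡prod ℓ _))))
                         (cong (λ k → branchLoss h ^ k * length leaves) length-seq) many

-- Density and counting over ℚ

⌜_⌝ : ℕ → ℚ
⌜ m ⌝ = mkℚ (ℤ.+ m) 0 (coprime-sym (1-coprimeTo m))

toℚ≡⌜⌝ : ∀ m → toℚ m ≡ ⌜ m ⌝
toℚ≡⌜⌝ m = ℚ.↥p/↧p≡p ⌜ m ⌝

⌜⌝-mono-≤ : ∀ {m n} → m ≤ n → ⌜ m ⌝ ℚ.≤ ⌜ n ⌝
⌜⌝-mono-≤ {m} {n} m≤n = *≤* (subst₂ ℤ._≤_ (sym (ℤ.*-identityʳ (ℤ.+ m))) (sym (ℤ.*-identityʳ (ℤ.+ n))) (ℤ.+≤+ m≤n))

⌜⌝-cancel-≤ : ∀ {m n} → ⌜ m ⌝ ℚ.≤ ⌜ n ⌝ → m ≤ n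
⌜⌝-cancel-≤ {m} {n} le = ℤ.drop‿+≤+ (subst₂ ℤ._≤_ (ℤ.*-identityʳ (ℤ.+ m)) (ℤ.*-identityʳ (ℤ.+ n)) (ℚ.drop-*≤* le))

⌜⌝-* : ∀ m n → ⌜ m ⌝ ℚ.* ⌜ n ⌝ ≡ ⌜ m * n ⌝
⌜⌝-* m n = ℚ.toℚᵘ-injective (ℚᵘ.≃-trans (ℚ.toℚᵘ-homo-* ⌜ m ⌝ ⌜ n ⌝) (ℚᵘ.*≡* (cong (ℤ._* ℤ.+ 1) (sym (ℤ.pos-* m n)))))

⌜⌝-+ : ∀ m n → ⌜ m ⌝ ℚ.+ ⌜ n ⌝ ≡ ⌜ m + n ⌝
⌜⌝-+ m n = ℚ.toℚᵘ-injective (ℚᵘ.≃-trans (ℚ.toℚᵘ-homo-+ ⌜ m ⌝ ⌜ n ⌝) (ℚᵘ.*≡* (cong (ℤ._* ℤ.+ 1) eq)))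
  where eq : ℤ.+ m ℤ.* ℤ.+ 1 ℤ.+ ℤ.+ n ℤ.* ℤ.+ 1 ≡ ℤ.+ (m + n)
        eq = trans (cong₂ ℤ._+_ (ℤ.*-identityʳ (ℤ.+ m)) (ℤ.*-identityʳ (ℤ.+ n))) (sym (ℤ.pos-+ m n))

module _ (k : ℕ) where

  density-bound : ∀ a b → (1ℚ - 1/ ⌜ suc k ⌝) ℚ.* toℚ a ℚ.≤ toℚ b → suc k * a ≤ suc k * b + a
  density-bound a b dense = ≤-trans (≤-reflexive (+-comm a (k * a))) (+-monoˡ-≤ a (⌜⌝-cancel-≤ scaled))
    where
      K : ℚ
      K = ⌜ suc k ⌝
      K*[1-1/K] : K ℚ.* (1ℚ - 1/ K) ≡ ⌜ k ⌝
      K*[1-1/K] = begin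
        K ℚ.* (1ℚ - 1/ K)                ≡⟨ ℚ.*-distribˡ-+ K 1ℚ (- 1/ K) ⟩
        K ℚ.* 1ℚ ℚ.+ K ℚ.* (- 1/ K)      ≡⟨ cong₂ ℚ._+_ (ℚ.*-identityʳ K) (sym (ℚ.neg-distribʳ-* K (1/ K))) ⟩
        K ℚ.+ - (K ℚ.* 1/ K)             ≡⟨ cong (λ z → K ℚ.+ - z) (ℚ.*-inverseʳ K) ⟩
        K ℚ.+ - 1ℚ                       ≡⟨ cong (ℚ._+ - 1ℚ) (trans (cong ⌜_⌝ (+-comm 1 k)) (sym (⌜⌝-+ k 1))) ⟩
        (⌜ k ⌝ ℚ.+ 1ℚ) ℚ.+ - 1ℚ          ≡⟨ ℚ.+-assoc ⌜ k ⌝ 1ℚ (- 1ℚ) ⟩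
        ⌜ k ⌝ ℚ.+ (1ℚ ℚ.+ - 1ℚ)          ≡⟨ cong (⌜ k ⌝ ℚ.+_) (ℚ.+-inverseʳ 1ℚ) ⟩
        ⌜ k ⌝ ℚ.+ 0ℚ                     ≡⟨ ℚ.+-identityʳ ⌜ k ⌝ ⟩
        ⌜ k ⌝                            ∎
        where open ≡-Reasoning
      scaled : ⌜ k * a ⌝ ℚ.≤ ⌜ suc k * b ⌝
      scaled = subst₂ ℚ._≤_ (trans (sym (ℚ.*-assoc K (1ℚ - 1/ K) ⌜ a ⌝)) (trans (cong (ℚ._* ⌜ a ⌝) K*[1-1/K]) (⌜⌝-* k a)))
                            (⌜⌝-* (suc k) b)
                            (ℚ.*-monoˡ-≤-nonNeg K (subst₂ ℚ._≤_ (cong ((1ℚ - 1/ K) ℚ.*_) (toℚ≡⌜⌝ a)) (toℚ≡⌜⌝ b) dense))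

  scaled-count : ∀ p m → p ≤ suc k * m → 1/ ⌜ suc k ⌝ ℚ.* toℚ p ℚ.≤ toℚ m
  scaled-count p m p≤ = subst₂ ℚ._≤_ (cong (1/ K ℚ.*_) (sym (toℚ≡⌜⌝ p))) (sym (toℚ≡⌜⌝ m))
    (ℚ.≤-trans (ℚ.*-monoˡ-≤-nonNeg (1/ K) (subst (⌜ p ⌝ ℚ.≤_) (sym (⌜⌝-* (suc k) m)) (⌜⌝-mono-≤ p≤)))
               (ℚ.≤-reflexive (trans (sym (ℚ.*-assoc (1/ K) K ⌜ m ⌝)) (trans (cong (ℚ._* ⌜ m ⌝) (ℚ.*-inverseˡ K)) (ℚ.*-identityˡ ⌜ m ⌝)))))
    where K : ℚ
          K = ⌜ suc k ⌝

∣∣≡# : ∀ {n} (X : Subset n) → ∣ X ∣ ≡ # (Vec.lookup X)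
∣∣≡# [] = refl
∣∣≡# (true ∷ X) = cong suc (∣∣≡# X)
∣∣≡# (false ∷ X) = ∣∣≡# X

module _ {n : ℕ} (T : Digraph n) (X Y : Subset n) where

  private
    X∋ Y∋ : Fin n → Bool
    X∋ = Vec.lookup X
    Y∋ = Vec.lookup Y

    forward : ℕ
    forward = ∑[ x < n ] ∑[ y < n ] 𝟙 (X∋ x ∧ (Y∋ y ∧ T x y))

  edgeCount≡forward : edgeCount T X Y ≡ forward
  edgeCount≡forward = trans (list-sum n (λ x → List.sum (map (λ y → 𝟙 (X∋ x ∧ Y∋ y ∧ T x y)) (allFin n))) (λ k → k))
                        (sum-cong-≗ (λ x → list-sum n (λ y → 𝟙 (X∋ x ∧ Y∋ y ∧ T x y)) (λ k → k)))
    where list-sum : ∀ {A : Set} m (f : A → ℕ) (g : Fin m → A) → List.sum (map f (tabulate g)) ≡ ∑[ k < m ] f (g k)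
          list-sum zero f g = refl
          list-sum (suc m) f g = cong (f (g zero) +_) (list-sum m f (g ∘ suc))

  forward+backPairs : forward + backPairs T X∋ Y∋ ≡ # X∋ * # Y∋
  forward+backPairs = begin
    forward + backPairs T X∋ Y∋                                ≡⟨ sym (sum-+ n (λ x → ∑[ y < n ] 𝟙 (X∋ x ∧ (Y∋ y ∧ T x y))) (λ x → ∑[ y < n ] 𝟙 (X∋ x ∧ (Y∋ y ∧ not (T x y))))) ⟩
    ∑[ x < n ] (∑[ y < n ] 𝟙 (X∋ x ∧ (Y∋ y ∧ T x y)) + ∑[ y < n ] 𝟙 (X∋ x ∧ (Y∋ y ∧ not (T x y))))
                                                              ≡⟨ sum-cong-≗ (λ x → sym (sum-+ n (λ y → 𝟙 (X∋ x ∧ (Y∋ y ∧ T x y))) (λ y → 𝟙 (X∋ x ∧ (Y∋ y ∧ not (T x y)))))) ⟩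
    ∑[ x < n ] ∑[ y < n ] (𝟙 (X∋ x ∧ (Y∋ y ∧ T x y)) + 𝟙 (X∋ x ∧ (Y∋ y ∧ not (T x y))))
                                                              ≡⟨ sum-cong-≗ (λ x → sum-cong-≗ (λ y → pointwise (X∋ x) (Y∋ y) (T x y))) ⟩
    ∑[ x < n ] ∑[ y < n ] (𝟙 (X∋ x) * 𝟙 (Y∋ y))              ≡⟨ sum-cong-≗ (λ x → sym (*-distribˡ-sum (𝟙 (X∋ x)) (𝟙 ∘ Y∋))) ⟩
    ∑[ x < n ] (𝟙 (X∋ x) * # Y∋)                              ≡⟨ sym (*-distribʳ-sum (# Y∋) (𝟙 ∘ X∋)) ⟩
    # X∋ * # Y∋                                               ∎
    where
      open ≡-Reasoning
      pointwise : ∀ a b c → 𝟙 (a ∧ (b ∧ c)) + 𝟙 (a ∧ (b ∧ not c)) ≡ 𝟙 a * 𝟙 b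
      pointwise false b c = refl
      pointwise true false c = refl
      pointwise true true false = refl
      pointwise true true true = refl

  dense⇒back-sparse : ∀ h → (1ℚ - 1/ ⌜ sparsity h ⌝) ℚ.* toℚ (∣ X ∣ * ∣ Y ∣) ℚ.≤ toℚ (edgeCount T X Y) →
                      sparsity h * backPairs T X∋ Y∋ ≤ # X∋ * # Y∋
  dense⇒back-sparse h dense = +-cancelʳ-≤ (Q * forward) _ _ (begin
      Q * backPairs T X∋ Y∋ + Q * forward    ≡⟨ sym (*-distribˡ-+ Q _ forward) ⟩
      Q * (backPairs T X∋ Y∋ + forward)      ≡⟨ cong (Q *_) (trans (+-comm _ forward) forward+backPairs) ⟩
      Q * (# X∋ * # Y∋)                      ≤⟨ subst₂ (λ a b → Q * a ≤ Q * b + a) (cong₂ _*_ (∣∣≡# X) (∣∣≡# Y)) edgeCount≡forward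
                                                  (density-bound (8 * badFactor h * 2 ^ h) (∣ X ∣ * ∣ Y ∣) (edgeCount T X Y) dense) ⟩
      Q * forward + # X∋ * # Y∋              ≡⟨ +-comm (Q * forward) _ ⟩
      # X∋ * # Y∋ + Q * forward              ∎)
    where
      open ≤-Reasoning
      Q : ℕ
      Q = sparsity h

-- dir i j records which of H_i → H_j and H_j → H_i the hypothesis provides (and dir i i = true).
module Orientation {h ℓ : ℕ} (H : Digraph h) (part : Fin h → Fin ℓ)
                   (ordered : ∀ i j → i Data.Fin.< j → PartArrow H part i j ⊎ PartArrow H part j i) where

  private
    isInj₁ : ∀ {A B : Set} → A ⊎ B → Bool
    isInj₁ (inj₁ _) = true
    isInj₁ (inj₂ _) = false

  dir : Fin ℓ → Fin ℓ → Bool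
  dir i j with <-cmpᶠ i j
  ... | tri< i<j _ _ = isInj₁ (ordered i j i<j)
  ... | tri≈ _ _ _ = true
  ... | tri> _ _ j<i = not (isInj₁ (ordered j i j<i))

  dir-refl : ∀ i → dir i i ≡ true
  dir-refl i with <-cmpᶠ i i
  ... | tri< i<i _ _ = ⊥-elim (<-irrefl refl i<i)
  ... | tri≈ _ _ _ = refl
  ... | tri> _ _ i<i = ⊥-elim (<-irrefl refl i<i)

  dir-flip : ∀ i j → i ≢ j → dir i j ≡ not (dir j i)
  dir-flip i j i≢j with <-cmpᶠ i j | <-cmpᶠ j i
  ... | tri< i<j _ _ | tri> _ _ i<j′ rewrite <-irrelevantᶠ i<j i<j′ = sym (not-involutive _)
  ... | tri> _ _ j<i | tri< j<i′ _ _ rewrite <-irrelevantᶠ j<i j<i′ = refl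
  ... | tri< i<j _ _ | tri< j<i _ _ = ⊥-elim (<-asymᶠ i<j j<i)
  ... | tri> _ _ j<i | tri> _ _ i<j = ⊥-elim (<-asymᶠ i<j j<i)
  ... | tri≈ _ i≡j _ | _ = ⊥-elim (i≢j i≡j)
  ... | tri< _ _ _ | tri≈ _ j≡i _ = ⊥-elim (i≢j (sym j≡i))
  ... | tri> _ _ _ | tri≈ _ j≡i _ = ⊥-elim (i≢j (sym j≡i))

  dir-arrow : ∀ i j → i ≢ j → dir i j ≡ true → PartArrow H part i j
  dir-arrow i j i≢j e with <-cmpᶠ i j
  ... | tri< i<j _ _ = left (ordered i j i<j) e
    where left : ∀ {A B : Set} (s : A ⊎ B) → isInj₁ s ≡ true → A
          left (inj₁ a) _ = a
  ... | tri≈ _ i≡j _ = ⊥-elim (i≢j i≡j)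
  ... | tri> _ _ j<i = right (ordered j i j<i) e
    where right : ∀ {A B : Set} (s : A ⊎ B) → not (isInj₁ s) ≡ true → B
          right (inj₂ b) _ = b

open import Data.Fin.Subset using (_∈_)

lookup-disjoint : ∀ {n ℓ} (W : Fin ℓ → Subset n) → (∀ i j → i ≢ j → ∀ x → x ∈ W i → ¬ x ∈ W j) →
                  ∀ i j x → Vec.lookup (W i) x ≡ true → Vec.lookup (W j) x ≡ true → i ≡ j
lookup-disjoint W disjoint i j x x∈i x∈j with i ≟ᶠ j
... | yes i≡j = i≡j
... | no i≢j = ⊥-elim (disjoint i j i≢j x (lookup⇒[]= x (W i) x∈i) (lookup⇒[]= x (W j) x∈j))

onto⇒≤ : ∀ {h ℓ} (part : Fin h → Fin ℓ) → (∀ i → ∃ λ v → part v ≡ i) → ℓ ≤ h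
onto⇒≤ part onto = injective⇒≤ {f = proj₁ ∘ onto} (λ {i} {j} e → trans (sym (proj₂ (onto i))) (trans (cong part e) (proj₂ (onto j))))

many-copies-in-dense-parts :
  ∀ h (H : Digraph h) → IsOriented H →
  ∀ ℓ (part : Fin h → Fin ℓ) → (∀ i → ∃ λ v → part v ≡ i) → (∀ i → PartAcyclic H part i) →
  (∀ i j → i Data.Fin.< j → PartArrow H part i j ⊎ PartArrow H part j i) →
  ∀ n (T : Digraph n) → IsTournament T → (W : Fin ℓ → Subset n) →
  (∀ i j → i ≢ j → ∀ x → x ∈ W i → ¬ x ∈ W j) → (∀ i → 2 ^ (h ∸ 1) ≤ ∣ W i ∣) →
  (∀ i j → i ≢ j → PartArrow H part i j →
     (1ℚ - 1/ ⌜ sparsity h ⌝) ℚ.* toℚ (∣ W i ∣ * ∣ W j ∣) ℚ.≤ toℚ (edgeCount T (W i) (W j))) →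
  Σ ℕ λ m → AtLeastCopies H T m × prodFin ℓ (λ i → ∣ W i ∣ ^ partSize part i) ≤ branchLoss h ^ h * m
many-copies-in-dense-parts h H oriented ℓ part onto acyclic ordered n T tournament W disjoint large dense =
  m , copies , subst (_≤ branchLoss h ^ h * m) (prodFin-cong ℓ (λ i → cong (_^ partSize part i) (sym (∣∣≡# (W i))))) bound
  where
    open Orientation H part ordered
    large′ : ∀ i → 2 ^ (h ∸ 1) ≤ # (Vec.lookup (W i))
    large′ i = subst (2 ^ (h ∸ 1) ≤_) (∣∣≡# (W i)) (large i)
    open GreedyEmbedding T tournament H (proj₁ oriented) (onto⇒≤ part onto) part (Vec.lookup ∘ W)
           (lookup-disjoint W disjoint) dir dir-refl dir-flip dir-arrow
           (λ i j i≢j e → dense⇒back-sparse T (W i) (W j) h (dense i j i≢j (dir-arrow i j i≢j e)))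
           (λ i → ≤-trans (m^n>0 2 (h ∸ 1)) (large′ i))
    result : Σ ℕ λ m → AtLeastCopies H T m × prodFin ℓ (λ i → # (Vec.lookup (W i)) ^ partSize part i) ≤ branchLoss h ^ h * m
    result = many-copies acyclic large′
    m : ℕ
    m = proj₁ result
    copies : AtLeastCopies H T m
    copies = proj₁ (proj₂ result)
    bound : prodFin ℓ (λ i → # (Vec.lookup (W i)) ^ partSize part i) ≤ branchLoss h ^ h * m
    bound = proj₂ (proj₂ result)

lemma3p3 : (h : ℕ) → Σ ℚ λ η → Σ ℚ λ α →
    (0ℚ Data.Rational.< η) × (0ℚ Data.Rational.< α) ×
    ((H : Digraph h) → IsOriented H →
     (ℓ : ℕ) (part : Fin h → Fin ℓ) →
     ((i : Fin ℓ) → ∃ λ v → part v ≡ i) →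
     ((i : Fin ℓ) → PartAcyclic H part i) →
     ((i j : Fin ℓ) → i Data.Fin.< j → PartArrow H part i j ⊎ PartArrow H part j i) →
     (n : ℕ) (T : Digraph n) → IsTournament T →
     (W : Fin ℓ → Subset n) →
     ((i j : Fin ℓ) → i ≢ j → (x : Fin n) → x ∈ W i → ¬ (x ∈ W j)) →
     ((i : Fin ℓ) → 2 ^ (h ∸ 1) ≤ ∣ W i ∣) →
     ((i j : Fin ℓ) → i ≢ j → PartArrow H part i j →
        (1ℚ - η) Data.Rational.* toℚ (∣ W i ∣ * ∣ W j ∣) Data.Rational.≤ toℚ (edgeCount T (W i) (W j))) →
     Σ ℕ λ m → AtLeastCopies H T m ×
       (α Data.Rational.* toℚ (prodFin ℓ (λ i → ∣ W i ∣ ^ partSize part i)) Data.Rational.≤ toℚ m))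
lemma3p3 h = η , α , ℚ.positive⁻¹ η , ℚ.positive⁻¹ α ,
  λ H oriented ℓ part onto acyclic ordered n T tournament W disjoint large dense →
    let m , copies , bound = many-copies-in-dense-parts h H oriented ℓ part onto acyclic ordered
                               n T tournament W disjoint large dense
    in m , copies , scaled-count (branchLoss h ^ h) _ m (≤-trans bound (*-monoˡ-≤ m (n≤1+n (branchLoss h ^ h))))
  where
    η α : ℚ
    η = 1/ ⌜ sparsity h ⌝
    α = 1/ ⌜ suc (branchLoss h ^ h) ⌝
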